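{- Let $G$ and $H$ be 3-connected quartic planar graphs such that $G$ is obtained from $H$ by a single 4-cycle addition. If $H$ admits a 4-locally self-avoiding Eulerian circuit, then so does $G$.
   Context: All graphs are finite and simple; quartic means 4-regular. 4-cycle addition: given a vertex $x$ of $H$ with neighbours $a,b,c,d$ in this cyclic order around $x$ in the plane embedding, subdivide the edges $xa,xb,xc,xd$ by new vertices $e,f,g,h$ respectively (so $ae,ex,bf,fx,cg,gx,dh,hx$ are edges) and add the 4-cycle $efghe$; the result is $G$. A circuit is a closed trail (no repeated edges), Eulerian if it uses every edge. A subcycle of a circuit $x_1\ldots x_n$ is a subtrail $x_i\ldots x_j$ of consecutive vertices (read cyclically) with $x_i=x_j$ and $x_i,\ldots,x_{j-1}$ distinct; a circuit is 4-locally self-avoiding if it has no subcycle of length at most 4. -}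

module Defs where

open import Data.Bool using (Bool; true; false; _∧_; _∨_; not; if_then_else_)
open import Data.Nat using (ℕ; zero; suc; _+_; _*_; _≤_; _<_; _≤ᵇ_)
open import Data.Nat.DivMod using (_mod_)
open import Data.Fin using (Fin; toℕ; splitAt) renaming (zero to f0; suc to fs)
open import Data.Fin.Properties using (_≟_)
open import Data.List using (List; []; _∷_; map; allFin; upTo; length)
open import Data.Nat.ListAction using (sum)
open import Data.List.Membership.Propositional using (_∉_)
open import Data.Product using (Σ; ∃; ∃-syntax; _×_; _,_; proj₁; proj₂)
open import Data.Sum using (_⊎_; inj₁; inj₂)
open import Relation.Nullary using (¬_)
open import Data.Unit using (⊤)
open import Relation.Nullary.Decidable using (⌊_⌋)
open import Relation.Binary.PropositionalEquality using (_≡_; _≢_)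
open import Function.Bundles using (_↔_; Inverse)

record Graph : Set where
  field
    n      : ℕ
    adj    : Fin n → Fin n → Bool
    sym    : ∀ u v → adj u v ≡ adj v u
    irrefl : ∀ u → adj u u ≡ false

open Graph public

count : ∀ {k} → (Fin k → Bool) → ℕ
count {k} p = sum (map (λ i → if p i then 1 else 0) (allFin k))

degree : (G : Graph) → Fin (n G) → ℕ
degree G u = count (adj G u)

Quartic : Graph → Set
Quartic G = ∀ u → degree G u ≡ 4

-- number of darts (ordered adjacent pairs) = 2 |E|
darts : Graph → ℕ
darts G = sum (map (degree G) (allFin (n G)))

data Reach (G : Graph) (ok : Fin (n G) → Set) : Fin (n G) → Fin (n G) → Set where
  here : ∀ u → Reach G ok u u
  step : ∀ {u v w} → adj G u v ≡ true → ok v → Reach G ok v w → Reach G ok u w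

ConnectedWithout : (G : Graph) → List (Fin (n G)) → Set
ConnectedWithout G S =
  ∀ u v → u ∉ S → v ∉ S → Reach G (λ w → w ∉ S) u v

Connected : Graph → Set
Connected G = ∀ u v → Reach G (λ _ → ⊤) u v

ThreeConnected : Graph → Set
ThreeConnected G =
  4 ≤ n G × (∀ (S : List (Fin (n G))) → length S ≤ 2 → ConnectedWithout G S)

-- Plane embeddings as rotation systems (combinatorial maps).
-- rot v u = the neighbour of v following u in the cyclic (clockwise)
-- order of the neighbours around v.

allB : ∀ {A : Set} → (A → Bool) → List A → Bool
allB p []       = true
allB p (x ∷ xs) = p x ∧ allB p xs

iter : ∀ {A : Set} → (A → A) → ℕ → A → A
iter f zero    a = a
iter f (suc k) a = f (iter f k a)

IsRotation : (G : Graph) → (Fin (n G) → Fin (n G) → Fin (n G)) → Set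
IsRotation G rot =
  (∀ v u → adj G v u ≡ true → adj G v (rot v u) ≡ true)
  × (∀ v u w → adj G v u ≡ true → adj G v w ≡ true → rot v u ≡ rot v w → u ≡ w)
  × (∀ v u w → adj G v u ≡ true → adj G v w ≡ true → ∃[ k ] iter (rot v) k u ≡ w)

faceStep : (G : Graph) → (Fin (n G) → Fin (n G) → Fin (n G))
         → Fin (n G) × Fin (n G) → Fin (n G) × Fin (n G)
faceStep G rot (u , v) = (v , rot v u)

dartKey : (G : Graph) → Fin (n G) × Fin (n G) → ℕ
dartKey G (u , v) = toℕ u * n G + toℕ v

-- a dart is the representative of its face if it has the least key in its
-- face-orbit (orbits have length ≤ number of darts ≤ n*n)
isFaceRep : (G : Graph) → (Fin (n G) → Fin (n G) → Fin (n G))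
          → Fin (n G) × Fin (n G) → Bool
isFaceRep G rot d =
  allB (λ k → dartKey G d ≤ᵇ dartKey G (iter (faceStep G rot) k d)) (upTo (n G * n G))

numFaces : (G : Graph) → (Fin (n G) → Fin (n G) → Fin (n G)) → ℕ
numFaces G rot =
  sum (map (λ u → count (λ v → adj G u v ∧ isFaceRep G rot (u , v))) (allFin (n G)))

-- a rotation system of a connected graph is a plane embedding iff
-- Euler's formula V - E + F = 2 holds  (here: 2V + 2F = 2E + 4)
IsPlaneRotation : (G : Graph) → (Fin (n G) → Fin (n G) → Fin (n G)) → Set
IsPlaneRotation G rot =
  IsRotation G rot × (2 * n G + 2 * numFaces G rot ≡ darts G + 4)

Planar : Graph → Set
Planar G = Connected G × (∃[ rot ] IsPlaneRotation G rot)

-- 4-cycle addition (concrete construction on Fin (m + 4))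
-- new vertices: index 0 = e (on xa), 1 = f (on xb), 2 = g (on xc), 3 = h (on xd)

_==_ : ∀ {k} → Fin k → Fin k → Bool
i == j = ⌊ i ≟ j ⌋

c4adj : Fin 4 → Fin 4 → Bool
c4adj f0 (fs f0) = true
c4adj (fs f0) f0 = true
c4adj (fs f0) (fs (fs f0)) = true
c4adj (fs (fs f0)) (fs f0) = true
c4adj (fs (fs f0)) (fs (fs (fs f0))) = true
c4adj (fs (fs (fs f0))) (fs (fs f0)) = true
c4adj (fs (fs (fs f0))) f0 = true
c4adj f0 (fs (fs (fs f0))) = true
c4adj _ _ = false

module FourCycle {m : ℕ} (adjH : Fin m → Fin m → Bool) (x a b c d : Fin m) where

  endp : Fin 4 → Fin m
  endp f0 = a
  endp (fs f0) = b
  endp (fs (fs f0)) = c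
  endp (fs (fs (fs f0))) = d

  isNbr : Fin m → Bool
  isNbr u = (u == a) ∨ (u == b) ∨ (u == c) ∨ (u == d)

  -- the subdivided edges xa, xb, xc, xd
  removed : Fin m → Fin m → Bool
  removed u v = ((u == x) ∧ isNbr v) ∨ ((v == x) ∧ isNbr u)

  adj⊎ : Fin m ⊎ Fin 4 → Fin m ⊎ Fin 4 → Bool
  adj⊎ (inj₁ u) (inj₁ v) = adjH u v ∧ not (removed u v)
  adj⊎ (inj₁ u) (inj₂ i) = (u == x) ∨ (u == endp i)
  adj⊎ (inj₂ i) (inj₁ u) = (u == x) ∨ (u == endp i)
  adj⊎ (inj₂ i) (inj₂ j) = c4adj i j

  adjNew : Fin (m + 4) → Fin (m + 4) → Bool
  adjNew u v = adj⊎ (splitAt m u) (splitAt m v)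

IsoTo : (G : Graph) (k : ℕ) → (Fin k → Fin k → Bool) → Set
IsoTo G k adj' =
  Σ (Fin (n G) ↔ Fin k) λ π →
    ∀ u v → adj' (Inverse.to π u) (Inverse.to π v) ≡ adj G u v

-- G is obtained from H by a 4-cycle addition at a vertex x whose neighbours
-- are a, b, c, d in this cyclic order in a plane embedding of H
FourCycleAddition : (H G : Graph) → Set
FourCycleAddition H G =
  ∃[ rot ] IsPlaneRotation H rot ×
    (∃[ x ] ∃[ a ] (adj H x a ≡ true ×
      IsoTo G (n H + 4)
        (FourCycle.adjNew (adj H) x a (rot x a) (rot x (rot x a))
                                      (rot x (rot x (rot x a))))))

-- Circuits: cyclic vertex sequences x_0 … x_{L-1}, x_L = x_0, L = suc k.

record CyclicSeq (G : Graph) : Set where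
  field
    k   : ℕ
    seq : Fin (suc k) → Fin (n G)

  L : ℕ
  L = suc k

  at : ℕ → Fin (n G)
  at i = seq (i mod L)

open CyclicSeq public

SameEdge : ∀ {V : Set} → V × V → V × V → Set
SameEdge (p , q) (r , s) = (p ≡ r × q ≡ s) ⊎ (p ≡ s × q ≡ r)

IsCircuit : (G : Graph) → CyclicSeq G → Set
IsCircuit G C =
  (∀ i → i < L C → adj G (at C i) (at C (suc i)) ≡ true)
  × (∀ i j → i < L C → j < L C → i ≢ j →
       ¬ SameEdge (at C i , at C (suc i)) (at C j , at C (suc j)))

IsEulerian : (G : Graph) → CyclicSeq G → Set
IsEulerian G C =
  IsCircuit G C ×
  (∀ u v → adj G u v ≡ true →
     ∃[ i ] (i < L C × SameEdge (u , v) (at C i , at C (suc i))))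

IsSubcycle : (G : Graph) → CyclicSeq G → (i ℓ : ℕ) → Set
IsSubcycle G C i ℓ =
  i < L C × 1 ≤ ℓ × ℓ ≤ L C × at C (i + ℓ) ≡ at C i
  × (∀ p q → p < q → q < ℓ → at C (i + p) ≢ at C (i + q))

FourLocallySelfAvoiding : (G : Graph) → CyclicSeq G → Set
FourLocallySelfAvoiding G C = ∀ i ℓ → ℓ ≤ 4 → ¬ IsSubcycle G C i ℓ

Has4LSAEulerianCircuit : Graph → Set
Has4LSAEulerianCircuit G =
  ∃[ C ] (IsEulerian G C × FourLocallySelfAvoiding G C)

-- An Eulerian circuit of the quartic graph H passes through x exactly twice, entering and
-- leaving along the four edges at x, and each of the two excursions between the passages has
-- at least four inner vertices, since the circuit has no short subcycle.  In G, x is the hub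
-- of a wheel whose rim is the new 4-cycle, and each old edge at x now ends at a rim vertex.
-- Replacing each passage by a Hamiltonian path of the wheel between the corresponding rim
-- vertices gives a circuit of G; whatever the order of the four rim vertices, the two paths
-- can be chosen to split the eight wheel edges between them, so the circuit is Eulerian.
-- Each path has five distinct vertices, none of which lies on the excursions, so no subcycle
-- of length at most four appears.

module Submission where

open import Defs renaming (sym to adj-sym)
open import Data.Bool using (Bool; true; false; _∧_; _∨_; not; if_then_else_)
open import Data.Bool.Properties using (∨-zeroʳ; ∨-identityʳ; T-≡) renaming (_≟_ to _≟ᵇ_)
open import Data.Empty using (⊥; ⊥-elim)
open import Data.Unit using (⊤; tt)
open import Data.Nat using (ℕ; zero; suc; pred; _+_; _*_; _∸_; _≤_; _<_; _≤ᵇ_; z≤n; s≤s; NonZero; _<?_; _≤?_; allUpTo?; anyUpTo?)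
open import Data.Nat.Properties
open import Data.Nat.DivMod using (_%_; _/_; _mod_; m≡m%n+[m/n]*n; m%n<n; m<n⇒m%n≡m; m%n%n≡m%n; n%n≡0; %-distribˡ-+; [m+kn]%n≡m%n; [m+n]%n≡m%n)
open import Data.Nat.Induction using (<-rec)
open import Data.Nat.ListAction using (sum)
open import Data.Nat.Tactic.RingSolver using (solve-∀)
open import Data.Fin using (Fin; toℕ) renaming (zero to f0; suc to fs)
open import Data.Fin.Properties using (toℕ-fromℕ<; toℕ-injective; all?; +↔⊎) renaming (_≟_ to _≟ᶠ_)
open import Data.List using (List; []; _∷_; map; length)
open import Data.List.Properties using (map-tabulate)
open import Data.List.Membership.Propositional using (_∈_)
open import Data.List.Membership.DecPropositional (_≟ᶠ_ {4}) using (_∈?_)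
open import Data.List.Relation.Unary.Any using (here; there; any?)
open import Data.List.Relation.Unary.All as All using (All; []; _∷_)
open import Data.List.Relation.Unary.All.Properties using (¬Any⇒All¬)
open import Data.List.Relation.Unary.Unique.Propositional using (Unique; []; _∷_)
open import Data.List.Relation.Unary.Unique.Propositional.Properties using (map⁻)
open import Data.List.Relation.Unary.Unique.DecPropositional (_≟ᶠ_ {4}) using (unique?)
open import Data.Product using (Σ; ∃; ∃-syntax; _×_; _,_; proj₁; proj₂)
open import Data.Sum using (_⊎_; inj₁; inj₂)
open import Data.Sum.Properties using (inj₁-injective)
open import Function using (_∘_; id)
open import Function.Bundles using (_↔_; Inverse; Equivalence)
open import Function.Properties.Inverse using (↔-trans)
open import Relation.Nullary using (¬_; Dec; yes; no; ¬?; contradiction)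
open import Relation.Nullary.Decidable using (_×-dec_; _⊎-dec_; _→-dec_; from-yes)
open import Relation.Unary using (Decidable)
open import Relation.Binary.PropositionalEquality
open import Relation.Binary.Definitions using (tri<; tri≈; tri>)

==⇒≡ : ∀ {k} {u v : Fin k} → (u == v) ≡ true → u ≡ v
==⇒≡ {u = u} {v} eq with u ≟ᶠ v
... | yes u≡v = u≡v

≡⇒== : ∀ {k} {u v : Fin k} → u ≡ v → (u == v) ≡ true
≡⇒== {u = u} {v} u≡v with u ≟ᶠ v
... | yes _ = refl
... | no u≢v = contradiction u≡v u≢v

≢⇒== : ∀ {k} {u v : Fin k} → u ≢ v → (u == v) ≡ false
≢⇒== {u = u} {v} u≢v with u ≟ᶠ v
... | yes u≡v = contradiction u≡v u≢v
... | no _ = refl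

true≢false : true ≢ false
true≢false ()

indicator : Bool → ℕ
indicator b = if b then 1 else 0

count-suc : ∀ {k} (p : Fin (suc k) → Bool) → count p ≡ indicator (p f0) + count (p ∘ fs)
count-suc p = cong (indicator (p f0) +_) (cong sum
  (trans (map-tabulate fs (indicator ∘ p)) (sym (map-tabulate id (indicator ∘ p ∘ fs)))))

count-mono : ∀ {k} {p q : Fin k → Bool} → (∀ i → p i ≡ true → q i ≡ true) → count p ≤ count q
count-mono {zero} p⇒q = z≤n
count-mono {suc k} {p} {q} p⇒q
  rewrite count-suc p | count-suc q with p f0 in p0
... | true rewrite p⇒q f0 p0 = s≤s (count-mono (p⇒q ∘ fs))
... | false = ≤-trans (count-mono (p⇒q ∘ fs)) (m≤n+m (count (q ∘ fs)) (indicator (q f0)))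

count-∨ : ∀ {k} (p q : Fin k → Bool) → count (λ i → p i ∨ q i) ≤ count p + count q
count-∨ {zero} p q = z≤n
count-∨ {suc k} p q
  rewrite count-suc (λ i → p i ∨ q i) | count-suc p | count-suc q with p f0 | q f0
... | true  | true  = s≤s (≤-trans (count-∨ (p ∘ fs) (q ∘ fs)) (+-monoʳ-≤ (count (p ∘ fs)) (n≤1+n _)))
... | true  | false = s≤s (count-∨ (p ∘ fs) (q ∘ fs))
... | false | true  = ≤-trans (s≤s (count-∨ (p ∘ fs) (q ∘ fs))) (≤-reflexive (sym (+-suc _ _)))
... | false | false = count-∨ (p ∘ fs) (q ∘ fs)

count-∨-disjoint : ∀ {k} (p q : Fin k → Bool) → (∀ i → p i ≡ true → q i ≡ false) →
                   count (λ i → p i ∨ q i) ≡ count p + count q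
count-∨-disjoint {zero} p q disj = refl
count-∨-disjoint {suc k} p q disj
  rewrite count-suc (λ i → p i ∨ q i) | count-suc p | count-suc q with p f0 in p0 | q f0 in q0
... | true  | true  = contradiction (trans (sym q0) (disj f0 p0)) true≢false
... | true  | false = cong suc (count-∨-disjoint (p ∘ fs) (q ∘ fs) (disj ∘ fs))
... | false | true  = trans (cong suc (count-∨-disjoint (p ∘ fs) (q ∘ fs) (disj ∘ fs))) (sym (+-suc _ _))
... | false | false = count-∨-disjoint (p ∘ fs) (q ∘ fs) (disj ∘ fs)

count-cong : ∀ {k} {p q : Fin k → Bool} → (∀ i → p i ≡ q i) → count p ≡ count q
count-cong {zero} p≗q = refl
count-cong {suc k} {p} {q} p≗q = begin
  count p                             ≡⟨ count-suc p ⟩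
  indicator (p f0) + count (p ∘ fs)   ≡⟨ cong₂ _+_ (cong indicator (p≗q f0)) (count-cong (p≗q ∘ fs)) ⟩
  indicator (q f0) + count (q ∘ fs)   ≡⟨ count-suc q ⟨
  count q                             ∎
  where open ≡-Reasoning

count-false : ∀ k → count {k} (λ _ → false) ≡ 0
count-false zero = refl
count-false (suc k) = trans (count-suc {k} (λ _ → false)) (count-false k)

count-== : ∀ {k} (y : Fin k) → count (_== y) ≡ 1
count-== {suc k} f0 = trans (count-suc {k} (_== f0)) (cong suc (count-false k))
count-== {suc k} (fs y) =
  trans (count-suc {k} (_== fs y)) (trans (count-cong fs==fs) (count-== y))
  where
  fs==fs : ∀ i → (fs i == fs y) ≡ (i == y)
  fs==fs i with i ≟ᶠ y
  ... | yes _ = refl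
  ... | no _  = refl

_∈ᵇ_ : ∀ {k} → Fin k → List (Fin k) → Bool
v ∈ᵇ []      = false
v ∈ᵇ (y ∷ S) = (v == y) ∨ (v ∈ᵇ S)

∈⇒∈ᵇ : ∀ {k} {v : Fin k} {S} → v ∈ S → (v ∈ᵇ S) ≡ true
∈⇒∈ᵇ {v = v} (here refl) rewrite ≡⇒== {u = v} refl = refl
∈⇒∈ᵇ {v = v} (there {x = y} v∈S) rewrite ∈⇒∈ᵇ v∈S = ∨-zeroʳ (v == y)

∈ᵇ⇒∈ : ∀ {k} {v : Fin k} S → (v ∈ᵇ S) ≡ true → v ∈ S
∈ᵇ⇒∈ {v = v} (y ∷ S) eq with v == y in v=y
... | true  = here (==⇒≡ v=y)
... | false = there (∈ᵇ⇒∈ S eq)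

count-∈ᵇ-≤ : ∀ {k} (S : List (Fin k)) → count (_∈ᵇ S) ≤ length S
count-∈ᵇ-≤ {k} [] = ≤-reflexive (count-false k)
count-∈ᵇ-≤ (y ∷ S) = begin
  count (λ v → (v == y) ∨ (v ∈ᵇ S))  ≤⟨ count-∨ (_== y) (_∈ᵇ S) ⟩
  count (_== y) + count (_∈ᵇ S)      ≡⟨ cong (_+ count (_∈ᵇ S)) (count-== y) ⟩
  suc (count (_∈ᵇ S))                ≤⟨ s≤s (count-∈ᵇ-≤ S) ⟩
  suc (length S)                     ∎
  where open ≤-Reasoning

count-∈ᵇ-unique : ∀ {k} {S : List (Fin k)} → Unique S → count (_∈ᵇ S) ≡ length S
count-∈ᵇ-unique {k} [] = count-false k
count-∈ᵇ-unique {S = y ∷ S} (y∉S ∷ uniq) = begin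
  count (λ v → (v == y) ∨ (v ∈ᵇ S))  ≡⟨ count-∨-disjoint (_== y) (_∈ᵇ S) disjoint ⟩
  count (_== y) + count (_∈ᵇ S)      ≡⟨ cong₂ _+_ (count-== y) (count-∈ᵇ-unique uniq) ⟩
  suc (length S)                     ∎
  where
  open ≡-Reasoning
  disjoint : ∀ v → (v == y) ≡ true → (v ∈ᵇ S) ≡ false
  disjoint v v=y with v ∈ᵇ S in v∈S
  ... | true  = contradiction (sym (==⇒≡ v=y)) (All.lookup y∉S (∈ᵇ⇒∈ S v∈S))
  ... | false = refl

degree-≤-length : ∀ G {u} (S : List (Fin (n G))) →
                  (∀ {v} → adj G u v ≡ true → v ∈ S) → degree G u ≤ length S
degree-≤-length G S covers =
  ≤-trans (count-mono {p = adj G _} (λ v uv → ∈⇒∈ᵇ (covers uv))) (count-∈ᵇ-≤ S)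

length-≤-degree : ∀ G {u} {S : List (Fin (n G))} → Unique S →
                  (∀ {v} → v ∈ S → adj G u v ≡ true) → length S ≤ degree G u
length-≤-degree G {S = S} uniq within = begin
  length S ≡⟨ count-∈ᵇ-unique uniq ⟨
  count (_∈ᵇ S) ≤⟨ count-mono {q = adj G _} (λ v v∈S → within (∈ᵇ⇒∈ S v∈S)) ⟩
  degree G _ ∎
  where open ≤-Reasoning

SameEdge-sym : ∀ {A : Set} {e e' : A × A} → SameEdge e e' → SameEdge e' e
SameEdge-sym (inj₁ (refl , refl)) = inj₁ (refl , refl)
SameEdge-sym (inj₂ (refl , refl)) = inj₂ (refl , refl)

SameEdge-trans : ∀ {A : Set} {e₁ e₂ e₃ : A × A} → SameEdge e₁ e₂ → SameEdge e₂ e₃ → SameEdge e₁ e₃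
SameEdge-trans (inj₁ (refl , refl)) s = s
SameEdge-trans (inj₂ (refl , refl)) (inj₁ (refl , refl)) = inj₂ (refl , refl)
SameEdge-trans (inj₂ (refl , refl)) (inj₂ (refl , refl)) = inj₁ (refl , refl)

SameEdge-reflexive : ∀ {A : Set} {e e' : A × A} → e ≡ e' → SameEdge e e'
SameEdge-reflexive refl = inj₁ (refl , refl)

SameEdge-map : ∀ {A B : Set} (f : A → B) {p q r s} →
               SameEdge (p , q) (r , s) → SameEdge (f p , f q) (f r , f s)
SameEdge-map f (inj₁ (refl , refl)) = inj₁ (refl , refl)
SameEdge-map f (inj₂ (refl , refl)) = inj₂ (refl , refl)

SameEdge-reflect : ∀ {A B : Set} {f : A → B} → (∀ {p q} → f p ≡ f q → p ≡ q) →
                   ∀ {p q r s} → SameEdge (f p , f q) (f r , f s) → SameEdge (p , q) (r , s)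
SameEdge-reflect f-inj (inj₁ (p≡r , q≡s)) = inj₁ (f-inj p≡r , f-inj q≡s)
SameEdge-reflect f-inj (inj₂ (p≡s , q≡r)) = inj₂ (f-inj p≡s , f-inj q≡r)

[m+n%d]%d≡[m+n]%d : ∀ m n d .{{_ : NonZero d}} → (m + n % d) % d ≡ (m + n) % d
[m+n%d]%d≡[m+n]%d m n d = begin
  (m + n % d) % d            ≡⟨ %-distribˡ-+ m (n % d) d ⟩
  (m % d + n % d % d) % d    ≡⟨ cong (λ z → (m % d + z) % d) (m%n%n≡m%n n d) ⟩
  (m % d + n % d) % d        ≡⟨ %-distribˡ-+ m n d ⟨
  (m + n) % d                ∎
  where open ≡-Reasoning

+-cancelˡ-% : ∀ s {p q} k → (s + p) % suc k ≡ (s + q) % suc k → p % suc k ≡ q % suc k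
+-cancelˡ-% s {p} {q} k eq = begin
  p % d                          ≡⟨ [m+kn]%n≡m%n p s d ⟨
  (p + s * d) % d                ≡⟨ cong (_% d) (undo p) ⟨
  (c + (s + p)) % d              ≡⟨ [m+n%d]%d≡[m+n]%d c (s + p) d ⟨
  (c + (s + p) % d) % d          ≡⟨ cong (λ z → (c + z) % d) eq ⟩
  (c + (s + q) % d) % d          ≡⟨ [m+n%d]%d≡[m+n]%d c (s + q) d ⟩
  (c + (s + q)) % d              ≡⟨ cong (_% d) (undo q) ⟩
  (q + s * d) % d                ≡⟨ [m+kn]%n≡m%n q s d ⟩
  q % d                          ∎
  where
  open ≡-Reasoning
  d c : ℕ
  d = suc k
  c = s * k
  undo : ∀ r → c + (s + r) ≡ r + s * d
  undo r = identity s k r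
    where
    identity : ∀ s k r → s * k + (s + r) ≡ r + s * suc k
    identity = solve-∀

-- A 4-locally self-avoiding Eulerian circuit, unrolled into a walk of the given period;
-- no-short-return replaces the subcycle condition (see short-return⇒subcycle).
record EulerTour {V : Set} (E : V → V → Bool) : Set where
  field
    last : ℕ
    walk : ℕ → V

  period : ℕ
  period = suc last

  edge : ℕ → V × V
  edge p = walk p , walk (suc p)

  field
    periodic        : ∀ p → walk (p + period) ≡ walk p
    adjacent   : ∀ p → E (walk p) (walk (suc p)) ≡ true
    edge-injective  : ∀ {p q} → p < period → q < period → SameEdge (edge p) (edge q) → p ≡ q
    edge-surjective : ∀ {u v} → E u v ≡ true → ∃[ p ] (p < period × SameEdge (u , v) (edge p))
    no-short-return : ∀ p ℓ → 1 ≤ ℓ → ℓ ≤ 4 → walk (p + ℓ) ≢ walk p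

  walk-+* : ∀ p q → walk (p + q * period) ≡ walk p
  walk-+* p zero = cong walk (+-identityʳ p)
  walk-+* p (suc q) = begin
    walk (p + (period + q * period))   ≡⟨ cong walk (trans (sym (+-assoc p period (q * period))) (+-comm (p + period) (q * period))) ⟩
    walk (q * period + (p + period))   ≡⟨ cong walk (+-comm (q * period) (p + period)) ⟩
    walk (p + period + q * period)     ≡⟨ walk-+* (p + period) q ⟩
    walk (p + period)             ≡⟨ periodic p ⟩
    walk p                   ∎
    where open ≡-Reasoning

  walk-% : ∀ p → walk (p % period) ≡ walk p
  walk-% p = trans (sym (walk-+* (p % period) (p / period))) (cong walk (sym (m≡m%n+[m/n]*n p period)))

  walk-cong-% : ∀ {p q} → p % period ≡ q % period → walk p ≡ walk q
  walk-cong-% {p} {q} eq = trans (sym (walk-% p)) (trans (cong walk eq) (walk-% q))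

  edge-cong-% : ∀ {p q} → p % period ≡ q % period → edge p ≡ edge q
  edge-cong-% {p} {q} eq = cong₂ _,_ (walk-cong-% eq) (walk-cong-% suc-eq)
    where
    suc-eq : suc p % period ≡ suc q % period
    suc-eq = begin
      (1 + p) % period        ≡⟨ [m+n%d]%d≡[m+n]%d 1 p period ⟨
      (1 + p % period) % period    ≡⟨ cong (λ z → (1 + z) % period) eq ⟩
      (1 + q % period) % period    ≡⟨ [m+n%d]%d≡[m+n]%d 1 q period ⟩
      (1 + q) % period        ∎
      where open ≡-Reasoning

  edge-injective-% : ∀ p q → SameEdge (edge p) (edge q) → p % period ≡ q % period
  edge-injective-% p q same =
    edge-injective (m%n<n p period) (m%n<n q period)
      (subst₂ SameEdge (edge-cong-% (sym (m%n%n≡m%n p period))) (edge-cong-% (sym (m%n%n≡m%n q period))) same)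

module _ {G : Graph} (C : CyclicSeq G) where

  at-cong-% : ∀ i j → i % L C ≡ j % L C → at C i ≡ at C j
  at-cong-% i j eq = cong (seq C) (toℕ-injective (begin
    toℕ (i mod L C)   ≡⟨ toℕ-fromℕ< (m%n<n i (L C)) ⟩
    i % L C           ≡⟨ eq ⟩
    j % L C           ≡⟨ toℕ-fromℕ< (m%n<n j (L C)) ⟨
    toℕ (j mod L C)   ∎))
    where open ≡-Reasoning

  at-%-+ : ∀ i p → at C (i % L C + p) ≡ at C (i + p)
  at-%-+ i p = at-cong-% (i % L C + p) (i + p) (begin
    (i % L C + p) % L C   ≡⟨ cong (_% L C) (+-comm (i % L C) p) ⟩
    (p + i % L C) % L C   ≡⟨ [m+n%d]%d≡[m+n]%d p i (L C) ⟩
    (p + i) % L C         ≡⟨ cong (_% L C) (+-comm p i) ⟩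
    (i + p) % L C         ∎)
    where open ≡-Reasoning

  -- A repetition within distance four shrinks, through nested repetitions, to a subcycle.
  short-return⇒subcycle : FourLocallySelfAvoiding G C →
                          ∀ ℓ i → 1 ≤ ℓ → ℓ ≤ 4 → at C (i + ℓ) ≢ at C i
  short-return⇒subcycle lsa = <-rec _ shrink
    where
    shrink : ∀ ℓ → (∀ {ℓ'} → ℓ' < ℓ → ∀ i → 1 ≤ ℓ' → ℓ' ≤ 4 → at C (i + ℓ') ≢ at C i) →
             ∀ i → 1 ≤ ℓ → ℓ ≤ 4 → at C (i + ℓ) ≢ at C i
    shrink ℓ rec i 1≤ℓ ℓ≤4 ret with L C <? ℓ
    ... | yes L<ℓ = rec L<ℓ i (s≤s z≤n) (≤-trans (<⇒≤ L<ℓ) ℓ≤4) (at-cong-% (i + L C) i ([m+n]%n≡m%n i (L C)))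
    ... | no ℓ≮L with anyUpTo? (λ q → anyUpTo? (λ p → at C (i + p) ≟ᶠ at C (i + q)) q) ℓ
    ...   | yes (q , q<ℓ , p , p<q , eq) =
            rec (≤-<-trans (m∸n≤m q p) q<ℓ) (i + p) (m<n⇒0<n∸m p<q)
                (≤-trans (m∸n≤m q p) (≤-trans (<⇒≤ q<ℓ) ℓ≤4))
                (trans (cong (at C) (trans (+-assoc i p (q ∸ p)) (cong (i +_) (m+[n∸m]≡n (<⇒≤ p<q))))) (sym eq))
    ...   | no no-repeat = lsa (i % L C) ℓ ℓ≤4
            ( m%n<n i (L C) , 1≤ℓ , ≮⇒≥ ℓ≮L
            , trans (at-%-+ i ℓ) (trans ret (at-cong-% i (i % L C) (sym (m%n%n≡m%n i (L C)))))
            , λ p q p<q q<ℓ eq → no-repeat (q , q<ℓ , p , p<q , trans (sym (at-%-+ i p)) (trans eq (at-%-+ i q))))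

tour-of-circuit : ∀ {G} (C : CyclicSeq G) → IsEulerian G C → FourLocallySelfAvoiding G C → EulerTour (adj G)
tour-of-circuit {G} C ((adjacent , trail) , covers) lsa = record
  { last            = k C
  ; walk            = at C
  ; periodic        = λ p → at-cong-% C (p + L C) p ([m+n]%n≡m%n p (L C))
  ; adjacent        = adjacent-everywhere
  ; edge-injective  = injective
  ; edge-surjective = covers _ _
  ; no-short-return = λ p ℓ → short-return⇒subcycle C lsa ℓ p
  }
  where
  adjacent-everywhere : ∀ p → adj G (at C p) (at C (suc p)) ≡ true
  adjacent-everywhere p =
    subst₂ (λ u v → adj G u v ≡ true)
      (at-cong-% C (p % L C) p (m%n%n≡m%n p (L C))) (at-cong-% C (suc (p % L C)) (suc p) ([m+n%d]%d≡[m+n]%d 1 p (L C)))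
      (adjacent (p % L C) (m%n<n p (L C)))
  injective : ∀ {p q} → p < L C → q < L C →
              SameEdge (at C p , at C (suc p)) (at C q , at C (suc q)) → p ≡ q
  injective {p} {q} p<L q<L same with p ≟ q
  ... | yes p≡q = p≡q
  ... | no p≢q = contradiction same (trail p q p<L q<L p≢q)

circuit-of-tour : ∀ {G} → EulerTour (adj G) → Has4LSAEulerianCircuit G
circuit-of-tour {G} T = C , ((adjacent′ , trail) , covers) , avoiding
  where
  open EulerTour T
  C : CyclicSeq G
  C = record { k = last ; seq = walk ∘ toℕ }
  at≡walk : ∀ i → at C i ≡ walk i
  at≡walk i = trans (cong walk (toℕ-fromℕ< (m%n<n i period))) (walk-% i)
  edge≡ : ∀ i → (at C i , at C (suc i)) ≡ edge i
  edge≡ i = cong₂ _,_ (at≡walk i) (at≡walk (suc i))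
  adjacent′ : ∀ i → i < L C → adj G (at C i) (at C (suc i)) ≡ true
  adjacent′ i _ = subst₂ (λ u v → adj G u v ≡ true) (sym (at≡walk i)) (sym (at≡walk (suc i))) (adjacent i)
  trail : ∀ i j → i < L C → j < L C → i ≢ j → ¬ SameEdge (at C i , at C (suc i)) (at C j , at C (suc j))
  trail i j i<L j<L i≢j same = i≢j (edge-injective i<L j<L (subst₂ SameEdge (edge≡ i) (edge≡ j) same))
  covers : ∀ u v → adj G u v ≡ true → ∃[ i ] (i < L C × SameEdge (u , v) (at C i , at C (suc i)))
  covers u v uv with edge-surjective uv
  ... | p , p<L , same = p , p<L , subst (SameEdge (u , v)) (sym (edge≡ p)) same
  avoiding : FourLocallySelfAvoiding G C
  avoiding i ℓ ℓ≤4 (_ , 1≤ℓ , _ , ret , _) =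
    no-short-return i ℓ 1≤ℓ ℓ≤4 (trans (sym (at≡walk (i + ℓ))) (trans ret (at≡walk i)))

shift : ∀ {V} {E : V → V → Bool} → EulerTour E → ℕ → EulerTour E
shift {V} {E} T s = record
  { last            = last
  ; walk            = walk′
  ; periodic        = λ p → trans (cong walk (sym (+-assoc s p period))) (periodic (s + p))
  ; adjacent        = λ p → subst (λ z → E (walk′ p) (walk z) ≡ true) (sym (+-suc s p)) (adjacent (s + p))
  ; edge-injective  = injective
  ; edge-surjective = surjective
  ; no-short-return = λ p ℓ 1≤ℓ ℓ≤4 ret →
      no-short-return (s + p) ℓ 1≤ℓ ℓ≤4 (trans (cong walk (+-assoc s p ℓ)) ret)
  }
  where
  open EulerTour T
  walk′ : ℕ → V
  walk′ p = walk (s + p)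
  edge′≡ : ∀ p → (walk′ p , walk′ (suc p)) ≡ edge (s + p)
  edge′≡ p = cong (walk′ p ,_) (cong walk (+-suc s p))
  injective : ∀ {p q} → p < period → q < period →
              SameEdge (walk′ p , walk′ (suc p)) (walk′ q , walk′ (suc q)) → p ≡ q
  injective {p} {q} p<L q<L same = begin
    p            ≡⟨ m<n⇒m%n≡m p<L ⟨
    p % period   ≡⟨ +-cancelˡ-% s last (edge-injective-% (s + p) (s + q) (subst₂ SameEdge (edge′≡ p) (edge′≡ q) same)) ⟩
    q % period   ≡⟨ m<n⇒m%n≡m q<L ⟩
    q            ∎
    where open ≡-Reasoning
  surjective : ∀ {u v} → E u v ≡ true → ∃[ p ] (p < period × SameEdge (u , v) (walk′ p , walk′ (suc p)))
  surjective uv with edge-surjective uv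
  ... | p , _ , same = p′ , m%n<n (p + s * last) period ,
        subst (SameEdge _) (sym (trans (edge′≡ p′) (edge-cong-% shifted))) same
    where
    p′ : ℕ
    p′ = (p + s * last) % period
    shifted : (s + p′) % period ≡ p % period
    shifted = begin
      (s + p′) % period                ≡⟨ [m+n%d]%d≡[m+n]%d s (p + s * last) period ⟩
      (s + (p + s * last)) % period    ≡⟨ cong (_% period) (identity s p last) ⟩
      (p + s * period) % period        ≡⟨ [m+kn]%n≡m%n p s period ⟩
      p % period                       ∎
      where
      open ≡-Reasoning
      identity : ∀ s p k → s + (p + s * k) ≡ p + s * suc k
      identity = solve-∀

transport : ∀ {V W} {E : V → V → Bool} {E′ : W → W → Bool} (σ : W ↔ V) →
            (∀ u v → E (Inverse.to σ u) (Inverse.to σ v) ≡ E′ u v) → EulerTour E → EulerTour E′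
transport {V} {W} {E} {E′} σ E≡E′ T = record
  { last            = last
  ; walk            = from ∘ walk
  ; periodic        = λ p → cong from (periodic p)
  ; adjacent        = λ p → trans (sym (E≡E′ _ _)) (subst₂ (λ a b → E a b ≡ true) (sym (to∘from _)) (sym (to∘from _)) (adjacent p))
  ; edge-injective  = λ p<L q<L same → edge-injective p<L q<L (SameEdge-reflect from-injective same)
  ; edge-surjective = surjective
  ; no-short-return = λ p ℓ 1≤ℓ ℓ≤4 ret → no-short-return p ℓ 1≤ℓ ℓ≤4 (from-injective ret)
  }
  where
  open EulerTour T
  open Inverse σ
  to∘from : ∀ v → to (from v) ≡ v
  to∘from = strictlyInverseˡ
  from-injective : ∀ {v v′} → from v ≡ from v′ → v ≡ v′
  from-injective {v} {v′} eq = trans (sym (to∘from v)) (trans (cong to eq) (to∘from v′))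
  surjective : ∀ {u v} → E′ u v ≡ true → ∃[ p ] (p < period × SameEdge (u , v) (from (walk p) , from (walk (suc p))))
  surjective {u} {v} uv with edge-surjective (trans (E≡E′ u v) uv)
  ... | p , p<L , same = p , p<L ,
        subst (λ e → SameEdge e _) (cong₂ _,_ (strictlyInverseʳ u) (strictlyInverseʳ v)) (SameEdge-map from same)

wheel : Fin 5 → Fin 5 → Bool
wheel f0     f0     = false
wheel f0     (fs _) = true
wheel (fs _) f0     = true
wheel (fs i) (fs j) = c4adj i j

hub : Fin 5
hub = f0

rim : Fin 4 → Fin 5
rim = fs

turn : Fin 4 → Fin 4
turn f0                = fs f0
turn (fs f0)           = fs (fs f0)
turn (fs (fs f0))      = fs (fs (fs f0))
turn (fs (fs (fs f0))) = f0

walk5 : ∀ {A : Set} → A → A → A → A → A → ℕ → A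
walk5 v₀ _  _  _  _  0 = v₀
walk5 _  v₁ _  _  _  1 = v₁
walk5 _  _  v₂ _  _  2 = v₂
walk5 _  _  _  v₃ _  3 = v₃
walk5 _  _  _  _  v₄ _ = v₄

-- A Hamiltonian path of the wheel from rim p to rim q ≠ p.  For any ordering p, q, r, s
-- of the rim, tour p q and tour r s split the eight edges of the wheel between them.
tour : Fin 4 → Fin 4 → ℕ → Fin 5
tour p q with q == turn p | q == turn (turn p)
... | true  | _     = walk5 (rim p) hub (rim (turn (turn (turn p)))) (rim (turn (turn p))) (rim q)
... | false | true  = walk5 (rim p) (rim (turn p)) hub (rim (turn (turn (turn p)))) (rim q)
... | false | false = walk5 (rim p) (rim (turn p)) (rim (turn (turn p))) hub (rim q)

tour-start : ∀ p q → tour p q 0 ≡ rim p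
tour-start p q with q == turn p | q == turn (turn p)
... | true  | _     = refl
... | false | true  = refl
... | false | false = refl

tour-end : ∀ p q → tour p q 4 ≡ rim q
tour-end p q with q == turn p | q == turn (turn p)
... | true  | _     = refl
... | false | true  = refl
... | false | false = refl

tours : Fin 4 → Fin 4 → Fin 4 → Fin 4 → Bool → ℕ → Fin 5
tours p q r s true  = tour p q
tours p q r s false = tour r s

private
  sameEdge? : ∀ {k} (e e′ : Fin k × Fin k) → Dec (SameEdge e e′)
  sameEdge? (p , q) (r , s) = ((p ≟ᶠ r) ×-dec (q ≟ᶠ s)) ⊎-dec ((p ≟ᶠ s) ×-dec (q ≟ᶠ r))

  all?ᵇ : {P : Bool → Set} → (∀ b → Dec (P b)) → Dec (∀ b → P b)
  all?ᵇ P? with P? true | P? false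
  ... | yes pt | yes pf = yes λ { true → pt ; false → pf }
  ... | no ¬pt | _      = no λ all → ¬pt (all true)
  ... | _      | no ¬pf = no λ all → ¬pf (all false)

  any?ᵇ : {P : Bool → Set} → (∀ b → Dec (P b)) → Dec (∃ P)
  any?ᵇ P? with P? true | P? false
  ... | yes pt | _      = yes (true , pt)
  ... | _      | yes pf = yes (false , pf)
  ... | no ¬pt | no ¬pf = no λ { (true , pt) → ¬pt pt ; (false , pf) → ¬pf pf }

-- Checked by exhaustive evaluation; opaque, so that uses do not re-run the evaluation.
opaque
  tour-adjacent : ∀ p q → p ≢ q → ∀ {o} → o < 4 → wheel (tour p q o) (tour p q (suc o)) ≡ true
  tour-adjacent = from-yes (all? λ p → all? λ q → ¬? (p ≟ᶠ q) →-dec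
                    allUpTo? (λ o → wheel (tour p q o) (tour p q (suc o)) ≟ᵇ true) 4)

  tour-injective : ∀ p q → p ≢ q → ∀ {o} → o < 5 → ∀ {o′} → o′ < 5 → tour p q o ≡ tour p q o′ → o ≡ o′
  tour-injective = from-yes (all? λ p → all? λ q → ¬? (p ≟ᶠ q) →-dec
                     allUpTo? (λ o → allUpTo? (λ o′ → (tour p q o ≟ᶠ tour p q o′) →-dec (o ≟ o′)) 5) 5)

  tours-edge-injective :
    ∀ p q r s → Unique (p ∷ q ∷ r ∷ s ∷ []) → ∀ t t′ → ∀ {o} → o < 4 → ∀ {o′} → o′ < 4 →
    SameEdge (tours p q r s t o , tours p q r s t (suc o)) (tours p q r s t′ o′ , tours p q r s t′ (suc o′)) →
    t ≡ t′ × o ≡ o′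
  tours-edge-injective = from-yes (all? λ p → all? λ q → all? λ r → all? λ s →
    unique? (p ∷ q ∷ r ∷ s ∷ []) →-dec
    all?ᵇ λ t → all?ᵇ λ t′ → allUpTo? (λ o → allUpTo? (λ o′ →
      sameEdge? (tours p q r s t o , tours p q r s t (suc o)) (tours p q r s t′ o′ , tours p q r s t′ (suc o′))
      →-dec ((t ≟ᵇ t′) ×-dec (o ≟ o′))) 4) 4)

  tours-cover :
    ∀ p q r s → Unique (p ∷ q ∷ r ∷ s ∷ []) → ∀ g g′ → wheel g g′ ≡ true →
    ∃[ t ] ∃[ o ] (o < 4 × SameEdge (g , g′) (tours p q r s t o , tours p q r s t (suc o)))
  tours-cover = from-yes (all? λ p → all? λ q → all? λ r → all? λ s →
    unique? (p ∷ q ∷ r ∷ s ∷ []) →-dec all? λ g → all? λ g′ → (wheel g g′ ≟ᵇ true) →-dec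
    any?ᵇ λ t → anyUpTo? (λ o → sameEdge? (g , g′) (tours p q r s t o , tours p q r s t (suc o))) 4)

  Fin4-exhausted : ∀ (p q r s : Fin 4) → Unique (p ∷ q ∷ r ∷ s ∷ []) → ∀ i → i ∈ p ∷ q ∷ r ∷ s ∷ []
  Fin4-exhausted = from-yes (all? λ p → all? λ q → all? λ r → all? λ s →
    unique? (p ∷ q ∷ r ∷ s ∷ []) →-dec all? λ i → i ∈? (p ∷ q ∷ r ∷ s ∷ []))

degree-exhausted : ∀ G {u} {S : List (Fin (n G))} → Unique S → degree G u ≤ length S →
                   (∀ {v} → v ∈ S → adj G u v ≡ true) → ∀ {w} → adj G u w ≡ true → w ∈ S
degree-exhausted G {S = S} uniq deg≤ within {w} uw with any? (w ≟ᶠ_) S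
... | yes w∈S = w∈S
... | no w∉S = contradiction (length-≤-degree G (¬Any⇒All¬ S w∉S ∷ uniq) within′) (<⇒≱ (s≤s deg≤))
  where
  within′ : ∀ {v} → v ∈ w ∷ S → adj G _ v ≡ true
  within′ (here refl) = uw
  within′ (there v∈S) = within v∈S

module RotationAt (H : Graph) {rot : Fin (n H) → Fin (n H) → Fin (n H)} (isRot : IsRotation H rot)
                  {x a : Fin (n H)} (degree≡4 : degree H x ≡ 4) (x∼a : adj H x a ≡ true) where

  b c d : Fin (n H)
  b = rot x a
  c = rot x b
  d = rot x c

  rot-adjacent : ∀ {v} → adj H x v ≡ true → adj H x (rot x v) ≡ true
  rot-adjacent = proj₁ isRot x _

  rot-injective : ∀ {v w} → adj H x v ≡ true → adj H x w ≡ true → rot x v ≡ rot x w → v ≡ w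
  rot-injective = proj₁ (proj₂ isRot) x _ _

  x∼b : adj H x b ≡ true
  x∼b = rot-adjacent x∼a
  x∼c : adj H x c ≡ true
  x∼c = rot-adjacent x∼b
  x∼d : adj H x d ≡ true
  x∼d = rot-adjacent x∼c

  ends-adjacent : ∀ i → adj H x (FourCycle.endp (adj H) x a b c d i) ≡ true
  ends-adjacent f0                = x∼a
  ends-adjacent (fs f0)           = x∼b
  ends-adjacent (fs (fs f0))      = x∼c
  ends-adjacent (fs (fs (fs f0))) = x∼d

  ¬short-orbit : ∀ S → length S < 4 → (∀ {y} → y ∈ S → rot x y ∈ S) → a ∈ S → ⊥
  ¬short-orbit S short closed a∈S = <⇒≱ short (subst (_≤ length S) degree≡4 (degree-≤-length H S covers))
    where
    orbit : ∀ j → iter (rot x) j a ∈ S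
    orbit zero    = a∈S
    orbit (suc j) = closed (orbit j)
    covers : ∀ {v} → adj H x v ≡ true → v ∈ S
    covers {v} xv with proj₂ (proj₂ isRot) x a v x∼a xv
    ... | j , reaches = subst (_∈ S) reaches (orbit j)

  a≢b : a ≢ b
  a≢b a≡b = ¬short-orbit (a ∷ []) (s≤s (s≤s z≤n)) (λ { (here refl) → here (sym a≡b) }) (here refl)

  a≢c : a ≢ c
  a≢c a≡c = ¬short-orbit (a ∷ b ∷ []) (s≤s (s≤s (s≤s z≤n)))
    (λ { (here refl) → there (here refl) ; (there (here refl)) → here (sym a≡c) }) (here refl)

  a≢d : a ≢ d
  a≢d a≡d = ¬short-orbit (a ∷ b ∷ c ∷ []) ≤-refl
    (λ { (here refl) → there (here refl) ; (there (here refl)) → there (there (here refl))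
       ; (there (there (here refl))) → here (sym a≡d) }) (here refl)

  neighbours-unique : Unique (a ∷ b ∷ c ∷ d ∷ [])
  neighbours-unique =
    (a≢b ∷ a≢c ∷ a≢d ∷ []) ∷ (b≢c ∷ b≢d ∷ []) ∷ (c≢d ∷ []) ∷ [] ∷ []
    where
    b≢c : b ≢ c
    b≢c = a≢b ∘ rot-injective x∼a x∼b
    b≢d : b ≢ d
    b≢d = a≢c ∘ rot-injective x∼a x∼c
    c≢d : c ≢ d
    c≢d = b≢c ∘ rot-injective x∼b x∼c

  neighbours : ∀ {v} → adj H x v ≡ true → v ∈ a ∷ b ∷ c ∷ d ∷ []
  neighbours = degree-exhausted H neighbours-unique (≤-reflexive degree≡4) λ
    { (here refl) → x∼a ; (there (here refl)) → x∼b ; (there (there (here refl))) → x∼c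
    ; (there (there (there (here refl)))) → x∼d }

least-witness : ∀ {P : ℕ → Set} → Decidable P → ∀ {n} → P n →
                ∃[ m ] (P m × m ≤ n × (∀ {m′} → m′ < m → ¬ P m′))
least-witness {P} P? = <-rec _ search _
  where
  search : ∀ n → (∀ {n′} → n′ < n → P n′ → ∃[ m ] (P m × m ≤ n′ × (∀ {m′} → m′ < m → ¬ P m′))) →
           P n → ∃[ m ] (P m × m ≤ n × (∀ {m′} → m′ < m → ¬ P m′))
  search n rec Pn with anyUpTo? P? n
  ... | yes (n′ , n′<n , Pn′) = let (m , Pm , m≤n′ , least) = rec n′<n Pn′ in m , Pm , ≤-trans m≤n′ (<⇒≤ n′<n) , least
  ... | no none = n , Pn , ≤-refl , λ m′<n Pm′ → none (_ , m′<n , Pm′)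

module _ {V : Set} {E : V → V → Bool} (T : EulerTour E) (x : V) where
  open EulerTour T

  Incident : ℕ → V → Set
  Incident p v = SameEdge (x , v) (edge p)

  incident-injective : ∀ {p q v} → p < period → q < period → Incident p v → Incident q v → p ≡ q
  incident-injective p<L q<L xv∼p xv∼q = edge-injective p<L q<L (SameEdge-trans (SameEdge-sym xv∼p) xv∼q)

  incident-distinct : ∀ {p q v w} → p < period → q < period → p ≢ q → Incident p v → Incident q w → v ≢ w
  incident-distinct p<L q<L p≢q xv∼p xw∼q refl = p≢q (incident-injective p<L q<L xv∼p xw∼q)

-- The tour is at x at time 0, again after the nA inner vertices of a first excursion,
-- and again after the nB inner vertices of a second one.
record Revisit {V : Set} {E : V → V → Bool} (T : EulerTour E) (x : V) : Set where
  open EulerTour T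
  field
    nA nB     : ℕ
    4≤nA      : 4 ≤ nA
    4≤nB      : 4 ≤ nB
    period≡   : period ≡ suc nA + suc nB
    at-start  : walk 0 ≡ x
    at-middle : walk (suc nA) ≡ x

  at-end : walk (suc nA + suc nB) ≡ x
  at-end = trans (cong walk (sym period≡)) (trans (periodic 0) at-start)

incident-adjacent : ∀ (H : Graph) (T : EulerTour (adj H)) {x p v} → Incident T x p v → adj H x v ≡ true
incident-adjacent H T {p = p} (inj₁ (refl , refl)) = EulerTour.adjacent T p
incident-adjacent H T {p = p} (inj₂ (refl , refl)) = trans (adj-sym H _ _) (EulerTour.adjacent T p)

-- The neighbours through which the tour enters and leaves x, in the order
-- enter, leave, enter, leave.
module Ports {H : Graph} {T : EulerTour (adj H)} {x : Fin (n H)} (R : Revisit T x) where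
  open EulerTour T
  open Revisit R

  ports : List (Fin (n H))
  ports = walk nA ∷ walk (suc (suc nA)) ∷ walk (suc nA + nB) ∷ walk 1 ∷ []

  nA<period : nA < period
  nA<period = subst (nA <_) (sym period≡) (m≤m+n (suc nA) (suc nB))

  suc-nA<period : suc nA < period
  suc-nA<period = subst (suc nA <_) (sym period≡) (m<m+n (suc nA) (s≤s z≤n))

  suc-nA+nB<period : suc nA + nB < period
  suc-nA+nB<period = subst (suc nA + nB <_) (sym period≡) (+-monoʳ-< (suc nA) (n<1+n nB))

  incident₁ : Incident T x nA (walk nA)
  incident₁ = inj₂ (sym at-middle , refl)
  incident₂ : Incident T x (suc nA) (walk (suc (suc nA)))
  incident₂ = inj₁ (sym at-middle , refl)
  incident₃ : Incident T x (suc nA + nB) (walk (suc nA + nB))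
  incident₃ = inj₂ (trans (sym at-end) (cong walk (+-suc (suc nA) nB)) , refl)
  incident₄ : Incident T x 0 (walk 1)
  incident₄ = inj₁ (sym at-start , refl)

  ports-unique : Unique ports
  ports-unique =
      (  distinct nA<period suc-nA<period (<⇒≢ (n<1+n nA)) incident₁ incident₂
       ∷ distinct nA<period suc-nA+nB<period (<⇒≢ (m≤m+n (suc nA) nB)) incident₁ incident₃
       ∷ distinct nA<period 0<period (>⇒≢ 0<nA) incident₁ incident₄ ∷ [])
    ∷ (  distinct suc-nA<period suc-nA+nB<period (<⇒≢ (m<m+n (suc nA) 0<nB)) incident₂ incident₃
       ∷ distinct suc-nA<period 0<period (λ ()) incident₂ incident₄ ∷ [])
    ∷ (distinct suc-nA+nB<period 0<period (λ ()) incident₃ incident₄ ∷ [])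
    ∷ [] ∷ []
    where
    distinct : ∀ {p q v w} → p < period → q < period → p ≢ q → Incident T x p v → Incident T x q w → v ≢ w
    distinct = incident-distinct T x
    0<period : 0 < period
    0<period = s≤s z≤n
    0<nA : 0 < nA
    0<nA = ≤-trans (s≤s z≤n) 4≤nA
    0<nB : 0 < nB
    0<nB = ≤-trans (s≤s z≤n) 4≤nB

  ports-adjacent : ∀ {v} → v ∈ ports → adj H x v ≡ true
  ports-adjacent (here refl)                         = incident-adjacent H T incident₁
  ports-adjacent (there (here refl))                 = incident-adjacent H T incident₂
  ports-adjacent (there (there (here refl)))         = incident-adjacent H T incident₃
  ports-adjacent (there (there (there (here refl)))) = incident-adjacent H T incident₄

record TwoVisits {V : Set} {E : V → V → Bool} (T : EulerTour E) (x : V) : Set where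
  field
    revisit : Revisit T x
  open Revisit revisit public
  field
    visits : ∀ {t} → t < EulerTour.period T → EulerTour.walk T t ≡ x → t ≡ 0 ⊎ t ≡ suc nA

module _ (H : Graph) {x : Fin (n H)} (degree≡4 : degree H x ≡ 4)
         (T : EulerTour (adj H)) (start : EulerTour.walk T 0 ≡ x) where
  open EulerTour T

  private
    first-return : ∃[ m ] (walk (suc m) ≡ x × m ≤ last × (∀ {m′} → m′ < m → walk (suc m′) ≢ x))
    first-return = least-witness (λ t → walk (suc t) ≟ᶠ x) {last} (trans (periodic 0) start)

    nA : ℕ
    nA = proj₁ first-return

    at-middle : walk (suc nA) ≡ x
    at-middle = proj₁ (proj₂ first-return)

    avoids-before-middle : ∀ {t} → 1 ≤ t → t ≤ nA → walk t ≢ x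
    avoids-before-middle {suc t} _ t<nA = proj₂ (proj₂ (proj₂ first-return)) t<nA

    4≤nA : 4 ≤ nA
    4≤nA with 4 ≤? nA
    ... | yes 4≤ = 4≤
    ... | no 4≰ = contradiction (trans at-middle (sym start)) (no-short-return 0 (suc nA) (s≤s z≤n) (≰⇒> 4≰))

    -- Visiting x only once would leave x with at most two neighbours.
    nA<last : nA < last
    nA<last with m≤n⇒m<n∨m≡n (proj₁ (proj₂ (proj₂ first-return)))
    ... | inj₁ nA<last = nA<last
    ... | inj₂ nA≡last = contradiction (subst (_≤ 2) degree≡4 (degree-≤-length H (walk 1 ∷ walk nA ∷ []) two-neighbours))
                                       (λ { (s≤s (s≤s ())) })
      where
      p≤nA : ∀ {p} → p < period → p ≤ nA
      p≤nA p<L = subst (_ ≤_) (sym nA≡last) (≤-pred p<L)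
      two-neighbours : ∀ {v} → adj H x v ≡ true → v ∈ walk 1 ∷ walk nA ∷ []
      two-neighbours xv with edge-surjective xv
      ... | zero  , _ , inj₁ (_ , v≡) = here v≡
      ... | suc p , p<L , inj₁ (x≡ , _) = contradiction (sym x≡) (avoids-before-middle (s≤s z≤n) (p≤nA p<L))
      ... | p , p<L , inj₂ (x≡ , v≡) with p <? nA
      ...   | yes p<nA = contradiction (sym x≡) (avoids-before-middle (s≤s z≤n) p<nA)
      ...   | no p≮nA = there (here (trans v≡ (cong walk (≤-antisym (p≤nA p<L) (≮⇒≥ p≮nA)))))

    nB : ℕ
    nB = last ∸ suc nA

    period≡ : period ≡ suc nA + suc nB
    period≡ = sym (trans (+-suc (suc nA) nB) (cong suc (m+[n∸m]≡n nA<last)))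

    4≤nB : 4 ≤ nB
    4≤nB with 4 ≤? nB
    ... | yes 4≤ = 4≤
    ... | no 4≰ = contradiction (trans at-end (sym at-middle)) (no-short-return (suc nA) (suc nB) (s≤s z≤n) (≰⇒> 4≰))
      where
      at-end : walk (suc nA + suc nB) ≡ x
      at-end = trans (cong walk (sym period≡)) (trans (periodic 0) start)

    revisit : Revisit T x
    revisit = record
      { nA = nA ; nB = nB ; 4≤nA = 4≤nA ; 4≤nB = 4≤nB ; period≡ = period≡
      ; at-start = start ; at-middle = at-middle }

    open Ports {H} revisit

    -- A third visit at t would make walk (t ∸ 1) a fifth neighbour of x, unless t ≡ nA + 2,
    -- where it would close a loop.
    visits : ∀ {t} → t < period → walk t ≡ x → t ≡ 0 ⊎ t ≡ suc nA
    visits {zero} _ _ = inj₁ refl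
    visits {suc t} t<L at-t with <-cmp t nA
    ... | tri< t<nA _ _ = contradiction at-t (avoids-before-middle (s≤s z≤n) t<nA)
    ... | tri≈ _ t≡nA _ = inj₂ (cong suc t≡nA)
    ... | tri> _ _ nA<t with m≤n⇒m<n∨m≡n nA<t
    ...   | inj₂ refl = contradiction (trans (cong walk (+-comm (suc nA) 1)) (trans at-t (sym at-middle)))
                                      (no-short-return (suc nA) 1 ≤-refl (s≤s z≤n))
    ...   | inj₁ suc-nA<t = ⊥-elim (elsewhere (degree-exhausted H ports-unique (≤-reflexive degree≡4) ports-adjacent
                                                 (incident-adjacent H T incident-t)))
      where
      incident-t : Incident T x t (walk t)
      incident-t = inj₂ (sym at-t , refl)
      clash : ∀ {q v} → q < period → Incident T x q v → walk t ≡ v → t ≡ q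
      clash q<L xv∼q eq = incident-injective T x (<-trans (n<1+n t) t<L) q<L incident-t (subst (Incident T x _) (sym eq) xv∼q)
      elsewhere : walk t ∈ ports → ⊥
      elsewhere (here eq) = contradiction (clash nA<period incident₁ eq) (>⇒≢ nA<t)
      elsewhere (there (here eq)) = contradiction (clash suc-nA<period incident₂ eq) (>⇒≢ suc-nA<t)
      elsewhere (there (there (here eq))) =
        <⇒≢ t<L (trans (cong suc (clash suc-nA+nB<period incident₃ eq)) (trans (sym (+-suc (suc nA) nB)) (sym period≡)))
      elsewhere (there (there (there (here eq)))) = contradiction (clash (s≤s z≤n) incident₄ eq) (>⇒≢ (<-trans (s≤s z≤n) suc-nA<t))

  two-visits : TwoVisits T x
  two-visits = record { revisit = revisit ; visits = visits }

module _ {V : Set} {E : V → V → Bool} (last : ℕ) (ψ : ℕ → V) where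

  private
    cyclic-edge : ℕ → V × V
    cyclic-edge r = ψ r , ψ (suc r % suc last)

  cyclic-tour :
    (∀ {r} → r < suc last → E (ψ r) (ψ (suc r % suc last)) ≡ true) →
    (∀ {r s} → r < suc last → s < suc last → SameEdge (cyclic-edge r) (cyclic-edge s) → r ≡ s) →
    (∀ {u v} → E u v ≡ true → ∃[ r ] (r < suc last × SameEdge (u , v) (cyclic-edge r))) →
    (∀ {r} ℓ → r < suc last → 1 ≤ ℓ → ℓ ≤ 4 → ψ ((r + ℓ) % suc last) ≢ ψ r) →
    EulerTour E
  cyclic-tour adjacent injective surjective no-return = record
    { last            = last
    ; walk            = walk
    ; periodic        = λ p → cong ψ ([m+n]%n≡m%n p N)
    ; adjacent        = λ p → subst (λ z → E (walk p) (ψ z) ≡ true) (suc-% p) (adjacent (m%n<n p N))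
    ; edge-injective  = λ {p} {q} p<N q<N same → injective p<N q<N (subst₂ SameEdge (edge≡ p<N) (edge≡ q<N) same)
    ; edge-surjective = λ uv → let (r , r<N , same) = surjective uv in
                               r , r<N , subst (SameEdge _) (sym (edge≡ r<N)) same
    ; no-short-return = λ p ℓ 1≤ℓ ℓ≤4 ret →
        no-return ℓ (m%n<n p N) 1≤ℓ ℓ≤4 (trans (cong ψ ([m%n+k]%n p ℓ)) ret)
    }
    where
    N : ℕ
    N = suc last
    walk : ℕ → V
    walk r = ψ (r % N)
    suc-% : ∀ p → suc (p % N) % N ≡ suc p % N
    suc-% p = [m+n%d]%d≡[m+n]%d 1 p N
    edge≡ : ∀ {r} → r < N → (walk r , walk (suc r)) ≡ cyclic-edge r
    edge≡ {r} r<N = cong (_, ψ (suc r % N)) (cong ψ (m<n⇒m%n≡m r<N))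
    [m%n+k]%n : ∀ p ℓ → (p % N + ℓ) % N ≡ (p + ℓ) % N
    [m%n+k]%n p ℓ = trans (cong (_% N) (+-comm (p % N) ℓ)) (trans ([m+n%d]%d≡[m+n]%d ℓ p N) (cong (_% N) (+-comm ℓ p)))

module Expansion (H : Graph) {x a b c d : Fin (n H)}
                 (ends-adjacent : ∀ i → adj H x (FourCycle.endp (adj H) x a b c d i) ≡ true)
                 (neighbours : ∀ {v} → adj H x v ≡ true → v ∈ a ∷ b ∷ c ∷ d ∷ [])
                 {T : EulerTour (adj H)} (twice : TwoVisits T x) where

  open FourCycle (adj H) x a b c d
  open EulerTour T
  open TwoVisits twice
  open Ports {H} revisit
  open ≡-Reasoning

  end-index : ∀ {v} → v ∈ a ∷ b ∷ c ∷ d ∷ [] → Fin 4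
  end-index (here _)                         = f0
  end-index (there (here _))                 = fs f0
  end-index (there (there (here _)))         = fs (fs f0)
  end-index (there (there (there (here _)))) = fs (fs (fs f0))

  endp-end-index : ∀ {v} (v∈ : v ∈ a ∷ b ∷ c ∷ d ∷ []) → endp (end-index v∈) ≡ v
  endp-end-index (here refl)                         = refl
  endp-end-index (there (here refl))                 = refl
  endp-end-index (there (there (here refl)))         = refl
  endp-end-index (there (there (there (here refl)))) = refl

  -- Opaque, so that later types do not unfold the neighbourhood argument behind the indices.
  opaque
    port-index : ∀ {v} → v ∈ ports → Fin 4
    port-index = end-index ∘ neighbours ∘ ports-adjacent

    endp-port-index : ∀ {v} (v∈ : v ∈ ports) → endp (port-index v∈) ≡ v
    endp-port-index = endp-end-index ∘ neighbours ∘ ports-adjacent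

  in₁ out₁ in₂ out₂ : Fin 4
  in₁  = port-index (here refl)
  out₁ = port-index (there (here refl))
  in₂  = port-index (there (there (here refl)))
  out₂ = port-index (there (there (there (here refl))))

  port-indices-unique : Unique (in₁ ∷ out₁ ∷ in₂ ∷ out₂ ∷ [])
  port-indices-unique = map⁻ {f = endp} (subst Unique (sym ends≡ports) ports-unique)
    where
    ends≡ports : map endp (in₁ ∷ out₁ ∷ in₂ ∷ out₂ ∷ []) ≡ ports
    ends≡ports = cong₂ _∷_ (endp-port-index (here refl)) (cong₂ _∷_ (endp-port-index (there (here refl)))
                   (cong₂ _∷_ (endp-port-index (there (there (here refl))))
                     (cong₂ _∷_ (endp-port-index (there (there (there (here refl))))) refl)))

  port₁ : walk nA ≡ endp in₁
  port₁ = sym (endp-port-index (here refl))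
  port₂ : walk (suc (suc nA)) ≡ endp out₁
  port₂ = sym (endp-port-index (there (here refl)))
  port₃ : walk (suc nA + nB) ≡ endp in₂
  port₃ = sym (endp-port-index (there (there (here refl))))
  port₄ : walk 1 ≡ endp out₂
  port₄ = sym (endp-port-index (there (there (there (here refl)))))

  in₁≢out₁ : in₁ ≢ out₁
  in₁≢out₁ with port-indices-unique
  ... | (≢out₁ ∷ _) ∷ _ = ≢out₁
  in₁≢in₂ : in₁ ≢ in₂
  in₁≢in₂ with port-indices-unique
  ... | (_ ∷ ≢in₂ ∷ _) ∷ _ = ≢in₂
  in₁≢out₂ : in₁ ≢ out₂
  in₁≢out₂ with port-indices-unique
  ... | (_ ∷ _ ∷ ≢out₂ ∷ _) ∷ _ = ≢out₂
  out₁≢in₂ : out₁ ≢ in₂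
  out₁≢in₂ with port-indices-unique
  ... | _ ∷ (≢in₂ ∷ _) ∷ _ = ≢in₂
  out₁≢out₂ : out₁ ≢ out₂
  out₁≢out₂ with port-indices-unique
  ... | _ ∷ (_ ∷ ≢out₂ ∷ _) ∷ _ = ≢out₂
  in₂≢out₂ : in₂ ≢ out₂
  in₂≢out₂ with port-indices-unique
  ... | _ ∷ _ ∷ (≢out₂ ∷ []) ∷ _ = ≢out₂

  avoids-A : ∀ {q} → q < nA → walk (suc q) ≢ x
  avoids-A {q} q<nA at-x with visits (<-trans (s≤s q<nA) suc-nA<period) at-x
  ... | inj₂ q≡nA = <⇒≢ q<nA (suc-injective q≡nA)

  avoids-B : ∀ {q} → q < nB → walk (suc (suc nA) + q) ≢ x
  avoids-B {q} q<nB at-x with visits t<period at-x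
    where
    t<period : suc (suc nA) + q < period
    t<period = subst (_< period) (+-suc (suc nA) q) (subst (suc nA + suc q <_) (sym period≡) (+-monoʳ-< (suc nA) (s≤s q<nB)))
  ... | inj₂ eq = <⇒≢ (s≤s (m≤m+n (suc nA) q)) (sym eq)

  Vertex : Set
  Vertex = Fin (n H) ⊎ Fin 4

  wheel-vertex : Fin 5 → Vertex
  wheel-vertex f0     = inj₁ x
  wheel-vertex (fs i) = inj₂ i

  crossing : Bool → ℕ → Fin 5
  crossing = tours in₁ out₁ in₂ out₂

  -- The tour of H with each visit of x replaced by a Hamiltonian path of the wheel on x, e, f, g, h:
  -- walk 1 … walk nA, crossing true, walk (nA + 2) … walk (nA + 1 + nB), crossing false.
  last′ : ℕ
  last′ = nA + 5 + nB + 4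

  period′ : ℕ
  period′ = suc last′

  private
    m+5+n∸3 : ∀ m n → m + 5 + n ∸ 3 ≡ suc (suc m) + n
    m+5+n∸3 m n = trans (cong (_∸ 3) (identity m n)) (m+n∸m≡n 3 (suc (suc m) + n))
      where
      identity : ∀ m n → m + 5 + n ≡ 3 + (suc (suc m) + n)
      identity = solve-∀

  opaque
    expanded : ℕ → Vertex
    expanded r with r <? nA
    ... | yes _ = inj₁ (walk (suc r))
    ... | no _ with r <? nA + 5
    ...   | yes _ = wheel-vertex (crossing true (r ∸ nA))
    ...   | no _ with r <? nA + 5 + nB
    ...     | yes _ = inj₁ (walk (r ∸ 3))
    ...     | no _ = wheel-vertex (crossing false (r ∸ (nA + 5 + nB)))

    expanded-A : ∀ {q} → q < nA → expanded q ≡ inj₁ (walk (suc q))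
    expanded-A {q} q<nA with q <? nA
    ... | yes _ = refl
    ... | no q≮nA = contradiction q<nA q≮nA

    expanded-first : ∀ {o} → o < 5 → expanded (nA + o) ≡ wheel-vertex (crossing true o)
    expanded-first {o} o<5 with nA + o <? nA
    ... | yes lt = contradiction lt (m+n≮m nA o)
    ... | no _ with nA + o <? nA + 5
    ...   | yes _ = cong (wheel-vertex ∘ crossing true) (m+n∸m≡n nA o)
    ...   | no ≮ = contradiction (+-monoʳ-< nA o<5) ≮

    expanded-B : ∀ {q} → q < nB → expanded (nA + 5 + q) ≡ inj₁ (walk (suc (suc nA) + q))
    expanded-B {q} q<nB with nA + 5 + q <? nA
    ... | yes lt = contradiction lt (≤⇒≯ (≤-trans (m≤m+n nA 5) (m≤m+n (nA + 5) q)))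
    ... | no _ with nA + 5 + q <? nA + 5
    ...   | yes lt = contradiction lt (m+n≮m (nA + 5) q)
    ...   | no _ with nA + 5 + q <? nA + 5 + nB
    ...     | yes _ = cong (inj₁ ∘ walk) (m+5+n∸3 nA q)
    ...     | no ≮ = contradiction (+-monoʳ-< (nA + 5) q<nB) ≮

    expanded-second : ∀ {o} → o < 5 → expanded (nA + 5 + nB + o) ≡ wheel-vertex (crossing false o)
    expanded-second {o} o<5 with nA + 5 + nB + o <? nA
    ... | yes lt = contradiction lt (≤⇒≯ (≤-trans (≤-trans (m≤m+n nA 5) (m≤m+n (nA + 5) nB)) (m≤m+n (nA + 5 + nB) o)))
    ... | no _ with nA + 5 + nB + o <? nA + 5
    ...   | yes lt = contradiction lt (≤⇒≯ (≤-trans (m≤m+n (nA + 5) nB) (m≤m+n (nA + 5 + nB) o)))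
    ...   | no _ with nA + 5 + nB + o <? nA + 5 + nB
    ...     | yes lt = contradiction lt (m+n≮m (nA + 5 + nB) o)
    ...     | no _ = cong (wheel-vertex ∘ crossing false) (m+n∸m≡n (nA + 5 + nB) o)

  expanded-edge : ℕ → Vertex × Vertex
  expanded-edge r = expanded r , expanded (suc r % period′)

  private
    <period′-A : ∀ {t} → t ≤ nA → t < period′
    <period′-A t≤nA = s≤s (≤-trans t≤nA (≤-trans (m≤m+n nA 5) (≤-trans (m≤m+n _ nB) (m≤m+n _ 4))))
    <period′-first : ∀ {o} → o ≤ 5 → nA + o < period′
    <period′-first o≤5 = s≤s (≤-trans (+-monoʳ-≤ nA o≤5) (≤-trans (m≤m+n _ nB) (m≤m+n _ 4)))
    <period′-B : ∀ {q} → q ≤ nB → nA + 5 + q < period′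
    <period′-B q≤nB = s≤s (≤-trans (+-monoʳ-≤ (nA + 5) q≤nB) (m≤m+n _ 4))
    <period′-second : ∀ {o} → o ≤ 4 → nA + 5 + nB + o < period′
    <period′-second o≤4 = s≤s (+-monoʳ-≤ (nA + 5 + nB) o≤4)

    expanded-suc : ∀ {r} → suc r < period′ → expanded (suc r % period′) ≡ expanded (suc r)
    expanded-suc r<L = cong expanded (m<n⇒m%n≡m r<L)

  crossing₁-start : crossing true 0 ≡ fs in₁
  crossing₁-start = tour-start in₁ out₁
  crossing₁-end : crossing true 4 ≡ fs out₁
  crossing₁-end = tour-end in₁ out₁
  crossing₂-start : crossing false 0 ≡ fs in₂
  crossing₂-start = tour-start in₂ out₂
  crossing₂-end : crossing false 4 ≡ fs out₂
  crossing₂-end = tour-end in₂ out₂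

  edge-A : ∀ {q} → suc q < nA → expanded-edge q ≡ (inj₁ (walk (suc q)) , inj₁ (walk (suc (suc q))))
  edge-A q<nA = cong₂ _,_ (expanded-A (<-trans (n<1+n _) q<nA))
                          (trans (expanded-suc (<period′-A (<⇒≤ q<nA))) (expanded-A q<nA))

  edge-enter₁ : ∀ {q} → suc q ≡ nA → expanded-edge q ≡ (inj₁ (walk nA) , inj₂ in₁)
  edge-enter₁ {q} sq≡nA = cong₂ _,_
    (trans (expanded-A (subst (q <_) sq≡nA (n<1+n q))) (cong (inj₁ ∘ walk) sq≡nA))
    (begin
      expanded (suc q % period′)      ≡⟨ expanded-suc (<period′-A (≤-reflexive sq≡nA)) ⟩
      expanded (suc q)                ≡⟨ cong expanded (trans sq≡nA (sym (+-identityʳ nA))) ⟩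
      expanded (nA + 0)               ≡⟨ expanded-first (s≤s z≤n) ⟩
      wheel-vertex (crossing true 0)  ≡⟨ cong wheel-vertex crossing₁-start ⟩
      inj₂ in₁                        ∎)

  edge-first : ∀ {o} → o < 4 → expanded-edge (nA + o) ≡ (wheel-vertex (crossing true o) , wheel-vertex (crossing true (suc o)))
  edge-first {o} o<4 = cong₂ _,_ (expanded-first (<-trans o<4 (n<1+n 4)))
    (begin
      expanded (suc (nA + o) % period′)   ≡⟨ expanded-suc (subst (_< period′) (+-suc nA o) (<period′-first (s≤s (<⇒≤ o<4)))) ⟩
      expanded (suc (nA + o))             ≡⟨ cong expanded (sym (+-suc nA o)) ⟩
      expanded (nA + suc o)               ≡⟨ expanded-first (s≤s o<4) ⟩
      wheel-vertex (crossing true (suc o)) ∎)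

  edge-leave₁ : expanded-edge (nA + 4) ≡ (inj₂ out₁ , inj₁ (walk (suc (suc nA))))
  edge-leave₁ = cong₂ _,_
    (trans (expanded-first (n<1+n 4)) (cong wheel-vertex crossing₁-end))
    (begin
      expanded (suc (nA + 4) % period′)   ≡⟨ expanded-suc (subst (_< period′) (+-suc nA 4) (<period′-first ≤-refl)) ⟩
      expanded (suc (nA + 4))             ≡⟨ cong expanded (trans (sym (+-suc nA 4)) (sym (+-identityʳ (nA + 5)))) ⟩
      expanded (nA + 5 + 0)               ≡⟨ expanded-B (≤-trans (s≤s z≤n) 4≤nB) ⟩
      inj₁ (walk (suc (suc nA) + 0))      ≡⟨ cong (inj₁ ∘ walk) (+-identityʳ _) ⟩
      inj₁ (walk (suc (suc nA)))          ∎)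

  edge-B : ∀ {q} → suc q < nB → expanded-edge (nA + 5 + q) ≡ (inj₁ (walk (suc (suc nA) + q)) , inj₁ (walk (suc (suc nA) + suc q)))
  edge-B {q} q<nB = cong₂ _,_ (expanded-B (<-trans (n<1+n q) q<nB))
    (begin
      expanded (suc (nA + 5 + q) % period′)  ≡⟨ expanded-suc (subst (_< period′) (+-suc (nA + 5) q) (<period′-B (<⇒≤ q<nB))) ⟩
      expanded (suc (nA + 5 + q))            ≡⟨ cong expanded (sym (+-suc (nA + 5) q)) ⟩
      expanded (nA + 5 + suc q)              ≡⟨ expanded-B q<nB ⟩
      inj₁ (walk (suc (suc nA) + suc q))     ∎)

  edge-enter₂ : ∀ {q} → suc q ≡ nB → expanded-edge (nA + 5 + q) ≡ (inj₁ (walk (suc nA + nB)) , inj₂ in₂)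
  edge-enter₂ {q} sq≡nB = cong₂ _,_
    (trans (expanded-B (subst (q <_) sq≡nB (n<1+n q)))
           (cong (inj₁ ∘ walk) (trans (sym (+-suc (suc nA) q)) (cong (suc nA +_) sq≡nB))))
    (begin
      expanded (suc (nA + 5 + q) % period′)  ≡⟨ expanded-suc (subst (_< period′) (+-suc (nA + 5) q) (<period′-B (≤-reflexive sq≡nB))) ⟩
      expanded (suc (nA + 5 + q))            ≡⟨ cong expanded (trans (sym (+-suc (nA + 5) q)) (trans (cong (nA + 5 +_) sq≡nB) (sym (+-identityʳ _)))) ⟩
      expanded (nA + 5 + nB + 0)             ≡⟨ expanded-second (s≤s z≤n) ⟩
      wheel-vertex (crossing false 0)        ≡⟨ cong wheel-vertex crossing₂-start ⟩
      inj₂ in₂                               ∎)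

  edge-second : ∀ {o} → o < 4 → expanded-edge (nA + 5 + nB + o) ≡ (wheel-vertex (crossing false o) , wheel-vertex (crossing false (suc o)))
  edge-second {o} o<4 = cong₂ _,_ (expanded-second (<-trans o<4 (n<1+n 4)))
    (begin
      expanded (suc (nA + 5 + nB + o) % period′)  ≡⟨ expanded-suc (subst (_< period′) (+-suc (nA + 5 + nB) o) (<period′-second o<4)) ⟩
      expanded (suc (nA + 5 + nB + o))            ≡⟨ cong expanded (sym (+-suc (nA + 5 + nB) o)) ⟩
      expanded (nA + 5 + nB + suc o)              ≡⟨ expanded-second (s≤s o<4) ⟩
      wheel-vertex (crossing false (suc o))       ∎)

  edge-leave₂ : expanded-edge last′ ≡ (inj₂ out₂ , inj₁ (walk 1))
  edge-leave₂ = cong₂ _,_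
    (trans (expanded-second (n<1+n 4)) (cong wheel-vertex crossing₂-end))
    (trans (cong expanded (n%n≡0 period′)) (expanded-A (≤-trans (s≤s z≤n) 4≤nA)))

  data Segment (r : ℕ) : Set where
    on-A      : ∀ {q} → q < nA → r ≡ q → Segment r
    on-first  : ∀ {o} → o < 5  → r ≡ nA + o → Segment r
    on-B      : ∀ {q} → q < nB → r ≡ nA + 5 + q → Segment r
    on-second : ∀ {o} → o < 5  → r ≡ nA + 5 + nB + o → Segment r

  private
    offset : ∀ {r m} k → ¬ r < m → r < m + k → ∃[ o ] (o < k × r ≡ m + o)
    offset {r} {m} k r≮m r<m+k = r ∸ m , +-cancelˡ-< m (r ∸ m) k (subst (_< m + k) r≡ r<m+k) , r≡
      where
      r≡ : r ≡ m + (r ∸ m)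
      r≡ = sym (m+[n∸m]≡n (≮⇒≥ r≮m))

  segment : ∀ {r} → r < period′ → Segment r
  segment {r} r<L with r <? nA
  ... | yes r<nA = on-A r<nA refl
  ... | no r≮nA with r <? nA + 5
  ...   | yes lt = let (_ , o<5 , eq) = offset 5 r≮nA lt in on-first o<5 eq
  ...   | no ≮₁ with r <? nA + 5 + nB
  ...     | yes lt = let (_ , q<nB , eq) = offset nB ≮₁ lt in on-B q<nB eq
  ...     | no ≮₂ = let (_ , o<5 , eq) = offset 5 ≮₂ (subst (r <_) (sym (+-suc (nA + 5 + nB) 4)) r<L) in on-second o<5 eq

  data Step (r : ℕ) : Set where
    along-A  : ∀ {q} → suc q < nA → r ≡ q → Step r
    enter₁   : ∀ {q} → suc q ≡ nA → r ≡ q → Step r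
    across₁  : ∀ {o} → o < 4 → r ≡ nA + o → Step r
    leave₁   : r ≡ nA + 4 → Step r
    along-B  : ∀ {q} → suc q < nB → r ≡ nA + 5 + q → Step r
    enter₂   : ∀ {q} → suc q ≡ nB → r ≡ nA + 5 + q → Step r
    across₂  : ∀ {o} → o < 4 → r ≡ nA + 5 + nB + o → Step r
    leave₂   : r ≡ last′ → Step r

  step-kind : ∀ {r} → r < period′ → Step r
  step-kind r<L with segment r<L
  ... | on-A {q} q<nA eq with suc q <? nA
  ...   | yes sq<nA = along-A sq<nA eq
  ...   | no sq≮nA = enter₁ (≤-antisym q<nA (≮⇒≥ sq≮nA)) eq
  step-kind r<L | on-first {o} o<5 eq with o <? 4
  ...   | yes o<4 = across₁ o<4 eq
  ...   | no o≮4 = leave₁ (trans eq (cong (nA +_) (≤-antisym (≤-pred o<5) (≮⇒≥ o≮4))))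
  step-kind r<L | on-B {q} q<nB eq with suc q <? nB
  ...   | yes sq<nB = along-B sq<nB eq
  ...   | no sq≮nB = enter₂ (≤-antisym q<nB (≮⇒≥ sq≮nB)) eq
  step-kind r<L | on-second {o} o<5 eq with o <? 4
  ...   | yes o<4 = across₂ o<4 eq
  ...   | no o≮4 = leave₂ (trans eq (cong (nA + 5 + nB +_) (≤-antisym (≤-pred o<5) (≮⇒≥ o≮4))))

  AdjacentPair : Vertex × Vertex → Set
  AdjacentPair (w , w′) = adj⊎ w w′ ≡ true

  adj⊎-wheel : ∀ g g′ → adj⊎ (wheel-vertex g) (wheel-vertex g′) ≡ wheel g g′
  adj⊎-wheel f0     f0     rewrite irrefl H x = refl
  adj⊎-wheel f0     (fs i) rewrite ≡⇒== {u = x} refl = refl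
  adj⊎-wheel (fs i) f0     rewrite ≡⇒== {u = x} refl = refl
  adj⊎-wheel (fs i) (fs j) = refl

  adj⊎-old : ∀ {u v} → u ≢ x → v ≢ x → adj H u v ≡ true → adj⊎ (inj₁ u) (inj₁ v) ≡ true
  adj⊎-old u≢x v≢x uv rewrite ≢⇒== u≢x | ≢⇒== v≢x | uv = refl

  adj⊎-link : ∀ {u i} → u ≡ endp i → adj⊎ (inj₁ u) (inj₂ i) ≡ true
  adj⊎-link {i = i} refl rewrite ≡⇒== {u = endp i} refl = ∨-zeroʳ _

  expanded-adjacent : ∀ {r} → r < period′ → AdjacentPair (expanded-edge r)
  expanded-adjacent r<L with step-kind r<L
  ... | along-A sq<nA refl = subst AdjacentPair (sym (edge-A sq<nA))
          (adj⊎-old (avoids-A (<-trans (n<1+n _) sq<nA)) (avoids-A sq<nA) (adjacent _))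
  ... | enter₁ sq≡nA refl = subst AdjacentPair (sym (edge-enter₁ sq≡nA)) (adj⊎-link port₁)
  ... | across₁ o<4 refl = subst AdjacentPair (sym (edge-first o<4))
          (trans (adj⊎-wheel (crossing true _) _) (tour-adjacent in₁ out₁ in₁≢out₁ o<4))
  ... | leave₁ refl = subst AdjacentPair (sym edge-leave₁) (adj⊎-link port₂)
  ... | along-B {q} sq<nB refl = subst AdjacentPair (sym (edge-B sq<nB))
          (adj⊎-old (avoids-B (<-trans (n<1+n _) sq<nB)) (avoids-B sq<nB)
                    (subst (λ t → adj H (walk (suc (suc nA) + q)) (walk t) ≡ true) (sym (+-suc (suc (suc nA)) q)) (adjacent _)))
  ... | enter₂ sq≡nB refl = subst AdjacentPair (sym (edge-enter₂ sq≡nB)) (adj⊎-link port₃)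
  ... | across₂ o<4 refl = subst AdjacentPair (sym (edge-second o<4))
          (trans (adj⊎-wheel (crossing false _) _) (tour-adjacent in₂ out₂ in₂≢out₂ o<4))
  ... | leave₂ refl = subst AdjacentPair (sym edge-leave₂) (adj⊎-link port₄)

  data EdgeName : Set where
    old        : ℕ → EdgeName
    link       : Fin 4 → EdgeName
    wheel-edge : Bool → ℕ → EdgeName

  named : EdgeName → Vertex × Vertex
  named (old p)          = inj₁ (walk p) , inj₁ (walk (suc p))
  named (link i)         = inj₁ (endp i) , inj₂ i
  named (wheel-edge t o) = wheel-vertex (crossing t o) , wheel-vertex (crossing t (suc o))

  Valid : EdgeName → Set
  Valid (old p)          = p < period × walk p ≢ x × walk (suc p) ≢ x
  Valid (link i)         = ⊤
  Valid (wheel-edge t o) = o < 4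

  position : EdgeName → ℕ
  position (old p)          = if p ≤ᵇ nA then pred p else p + 3
  position (link i)         = if i == in₁ then pred nA else if i == out₁ then nA + 4
                              else if i == in₂ then nA + 5 + pred nB else last′
  position (wheel-edge t o) = if t then nA + o else nA + 5 + nB + o

  private
    wheel-vertex-injective : ∀ {g g′} → wheel-vertex g ≡ wheel-vertex g′ → g ≡ g′
    wheel-vertex-injective {f0}   {f0}    _    = refl
    wheel-vertex-injective {fs i} {fs .i} refl = refl

    wheel-vertex-old : ∀ {g u} → wheel-vertex g ≡ inj₁ u → u ≡ x
    wheel-vertex-old {f0} refl = refl

    ends≢x : ∀ i → endp i ≢ x
    ends≢x i endp≡x = true≢false (trans (sym (subst (λ v → adj H x v ≡ true) endp≡x (ends-adjacent i))) (irrefl H x))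

  named-injective : ∀ {κ κ′} → Valid κ → Valid κ′ → SameEdge (named κ) (named κ′) → κ ≡ κ′
  named-injective {old p} {old p′} (p<L , _) (p′<L , _) same =
    cong old (edge-injective p<L p′<L (SameEdge-reflect inj₁-injective same))
  named-injective {old p} {link i} _ _ (inj₁ (_ , ()))
  named-injective {old p} {link i} _ _ (inj₂ (() , _))
  named-injective {old p} {wheel-edge t o} (_ , ≢x , _) _ (inj₁ (eq , _)) = ⊥-elim (≢x (wheel-vertex-old (sym eq)))
  named-injective {old p} {wheel-edge t o} (_ , ≢x , _) _ (inj₂ (eq , _)) = ⊥-elim (≢x (wheel-vertex-old (sym eq)))
  named-injective {link i} {old p} _ _ (inj₁ (_ , ()))
  named-injective {link i} {old p} _ _ (inj₂ (_ , ()))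
  named-injective {link i} {link .i} _ _ (inj₁ (_ , refl)) = refl
  named-injective {link i} {link i′} _ _ (inj₂ (() , _))
  named-injective {link i} {wheel-edge t o} _ _ (inj₁ (eq , _)) = ⊥-elim (ends≢x i (wheel-vertex-old (sym eq)))
  named-injective {link i} {wheel-edge t o} _ _ (inj₂ (eq , _)) = ⊥-elim (ends≢x i (wheel-vertex-old (sym eq)))
  named-injective {wheel-edge t o} {old p} _ (_ , ≢x , _) (inj₁ (eq , _)) = ⊥-elim (≢x (wheel-vertex-old eq))
  named-injective {wheel-edge t o} {old p} _ (_ , ≢x , _) (inj₂ (_ , eq)) = ⊥-elim (≢x (wheel-vertex-old eq))
  named-injective {wheel-edge t o} {link i} _ _ (inj₁ (eq , _)) = ⊥-elim (ends≢x i (wheel-vertex-old eq))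
  named-injective {wheel-edge t o} {link i} _ _ (inj₂ (_ , eq)) = ⊥-elim (ends≢x i (wheel-vertex-old eq))
  named-injective {wheel-edge t o} {wheel-edge t′ o′} o<4 o′<4 same =
    let (t≡t′ , o≡o′) = tours-edge-injective in₁ out₁ in₂ out₂ port-indices-unique t t′ o<4 o′<4
                          (SameEdge-reflect wheel-vertex-injective same)
    in cong₂ wheel-edge t≡t′ o≡o′

  private
    ≤ᵇ-true : ∀ {m n} → m ≤ n → (m ≤ᵇ n) ≡ true
    ≤ᵇ-true {m} {n} m≤n = Equivalence.to T-≡ (≤⇒≤ᵇ m≤n)

    ≤ᵇ-false : ∀ {m n} → ¬ m ≤ n → (m ≤ᵇ n) ≡ false
    ≤ᵇ-false {m} {n} m≰n with m ≤ᵇ n in eq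
    ... | true  = contradiction (≤ᵇ⇒≤ m n (Equivalence.from T-≡ eq)) m≰n
    ... | false = refl

  position-old-≤ : ∀ {p} → p ≤ nA → position (old p) ≡ pred p
  position-old-≤ p≤nA rewrite ≤ᵇ-true p≤nA = refl

  position-old-> : ∀ {p} → nA < p → position (old p) ≡ p + 3
  position-old-> nA<p rewrite ≤ᵇ-false (<⇒≱ nA<p) = refl

  position-in₁ : position (link in₁) ≡ pred nA
  position-in₁ rewrite ≡⇒== {u = in₁} refl = refl

  position-out₁ : position (link out₁) ≡ nA + 4
  position-out₁ rewrite ≢⇒== (≢-sym in₁≢out₁) | ≡⇒== {u = out₁} refl = refl

  position-in₂ : position (link in₂) ≡ nA + 5 + pred nB
  position-in₂ rewrite ≢⇒== (≢-sym in₁≢in₂) | ≢⇒== (≢-sym out₁≢in₂) | ≡⇒== {u = in₂} refl = refl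

  position-out₂ : position (link out₂) ≡ last′
  position-out₂ rewrite ≢⇒== (≢-sym in₁≢out₂) | ≢⇒== (≢-sym out₁≢out₂) | ≢⇒== (≢-sym in₂≢out₂) = refl

  edge-name : ∀ {r} → r < period′ → ∃[ κ ] (Valid κ × position κ ≡ r × SameEdge (expanded-edge r) (named κ))
  edge-name r<L with step-kind r<L
  ... | along-A {q} sq<nA refl =
        old (suc q)
      , (<-trans sq<nA nA<period , avoids-A (<-trans (n<1+n q) sq<nA) , avoids-A sq<nA)
      , position-old-≤ (<⇒≤ sq<nA)
      , SameEdge-reflexive (edge-A sq<nA)
  ... | enter₁ {q} sq≡nA refl =
        link in₁ , tt
      , trans position-in₁ (cong pred (sym sq≡nA))
      , SameEdge-reflexive (trans (edge-enter₁ sq≡nA) (cong (λ v → inj₁ v , inj₂ in₁) port₁))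
  ... | across₁ {o} o<4 refl = wheel-edge true o , o<4 , refl , SameEdge-reflexive (edge-first o<4)
  ... | leave₁ refl =
        link out₁ , tt , position-out₁
      , SameEdge-trans (SameEdge-reflexive edge-leave₁) (inj₂ (refl , cong inj₁ port₂))
  ... | along-B {q} sq<nB refl =
        old (suc (suc nA) + q)
      , ( subst (_< period) (+-suc (suc nA) q) (subst (suc nA + suc q <_) (sym period≡) (+-monoʳ-< (suc nA) (s≤s (<-trans (n<1+n q) sq<nB))))
        , avoids-B (<-trans (n<1+n q) sq<nB)
        , subst (λ t → walk t ≢ x) (+-suc (suc (suc nA)) q) (avoids-B sq<nB))
      , trans (position-old-> (s≤s (≤-trans (n≤1+n nA) (m≤m+n (suc nA) q)))) (identity nA q)
      , SameEdge-reflexive (trans (edge-B sq<nB) (cong (λ t → inj₁ (walk (suc (suc nA) + q)) , inj₁ (walk t)) (+-suc (suc (suc nA)) q)))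
    where
    identity : ∀ a q → suc (suc a) + q + 3 ≡ a + 5 + q
    identity = solve-∀
  ... | enter₂ {q} sq≡nB refl =
        link in₂ , tt , trans position-in₂ (cong (λ z → nA + 5 + pred z) (sym sq≡nB))
      , SameEdge-reflexive (trans (edge-enter₂ sq≡nB) (cong (λ v → inj₁ v , inj₂ in₂) port₃))
  ... | across₂ {o} o<4 refl = wheel-edge false o , o<4 , refl , SameEdge-reflexive (edge-second o<4)
  ... | leave₂ refl =
        link out₂ , tt , position-out₂
      , SameEdge-trans (SameEdge-reflexive edge-leave₂) (inj₂ (refl , cong inj₁ port₄))

  expanded-edge-injective : ∀ {r s} → r < period′ → s < period′ → SameEdge (expanded-edge r) (expanded-edge s) → r ≡ s
  expanded-edge-injective r<L s<L same with edge-name r<L | edge-name s<L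
  ... | κ , valid , pos , same-r | κ′ , valid′ , pos′ , same-s =
        trans (sym pos) (trans (cong position (named-injective valid valid′ named-same)) pos′)
    where
    named-same : SameEdge (named κ) (named κ′)
    named-same = SameEdge-trans (SameEdge-sym same-r) (SameEdge-trans same same-s)

  Covered : Vertex × Vertex → Set
  Covered e = ∃[ r ] (r < period′ × SameEdge e (expanded-edge r))

  covered-at : ∀ {e e′} r → r < period′ → expanded-edge r ≡ e′ → SameEdge e e′ → Covered e
  covered-at r r<L eq same = r , r<L , SameEdge-trans same (SameEdge-sym (SameEdge-reflexive eq))

  link-covered-in₁ : Covered (inj₁ (endp in₁) , inj₂ in₁)
  link-covered-in₁ = covered-at (nA ∸ 1) (<period′-A (m∸n≤m nA 1))
    (edge-enter₁ (m+[n∸m]≡n (≤-trans (s≤s z≤n) 4≤nA))) (inj₁ (cong inj₁ (sym port₁) , refl))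

  link-covered-out₁ : Covered (inj₁ (endp out₁) , inj₂ out₁)
  link-covered-out₁ = covered-at (nA + 4) (<period′-first (n≤1+n 4)) edge-leave₁ (inj₂ (cong inj₁ (sym port₂) , refl))

  link-covered-in₂ : Covered (inj₁ (endp in₂) , inj₂ in₂)
  link-covered-in₂ = covered-at (nA + 5 + (nB ∸ 1)) (<period′-B (m∸n≤m nB 1))
    (edge-enter₂ (m+[n∸m]≡n (≤-trans (s≤s z≤n) 4≤nB))) (inj₁ (cong inj₁ (sym port₃) , refl))

  link-covered-out₂ : Covered (inj₁ (endp out₂) , inj₂ out₂)
  link-covered-out₂ = covered-at last′ ≤-refl edge-leave₂ (inj₂ (cong inj₁ (sym port₄) , refl))

  link-covered : ∀ i → Covered (inj₁ (endp i) , inj₂ i)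
  link-covered i with Fin4-exhausted in₁ out₁ in₂ out₂ port-indices-unique i
  ... | here refl                         = link-covered-in₁
  ... | there (here refl)                 = link-covered-out₁
  ... | there (there (here refl))         = link-covered-in₂
  ... | there (there (there (here refl))) = link-covered-out₂

  wheel-covered : ∀ g g′ → wheel g g′ ≡ true → Covered (wheel-vertex g , wheel-vertex g′)
  wheel-covered g g′ gg′ with tours-cover in₁ out₁ in₂ out₂ port-indices-unique g g′ gg′
  ... | true  , o , o<4 , same = covered-at (nA + o) (<period′-first (<⇒≤ (<-trans o<4 (n<1+n 4))))
          (edge-first o<4) (SameEdge-map wheel-vertex same)
  ... | false , o , o<4 , same = covered-at (nA + 5 + nB + o) (<period′-second (<⇒≤ o<4))
          (edge-second o<4) (SameEdge-map wheel-vertex same)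

  data OldStep (p : ℕ) : Set where
    in-A : ∀ {q} → suc q < nA → p ≡ suc q → OldStep p
    in-B : ∀ {t} → suc t < nB → p ≡ suc (suc nA) + t → OldStep p

  old-step : ∀ {p} → p < period → walk p ≢ x → walk (suc p) ≢ x → OldStep p
  old-step {zero} _ ≢x _ = contradiction at-start ≢x
  old-step {suc q} p<L ≢x ≢x′ with suc q <? nA
  ... | yes sq<nA = in-A sq<nA refl
  ... | no sq≮nA with suc q <? suc (suc nA)
  ...   | yes sq<ssnA with m≤n⇒m<n∨m≡n (≮⇒≥ sq≮nA)
  ...     | inj₁ nA<sq = contradiction (cong walk (≤-antisym (≤-pred sq<ssnA) nA<sq)) (λ eq → ≢x (trans eq at-middle))
  ...     | inj₂ nA≡sq = contradiction (cong (walk ∘ suc) (sym nA≡sq)) (λ eq → ≢x′ (trans eq at-middle))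
  old-step {suc q} p<L ≢x ≢x′ | no _ | no sq≮ssnA
    with offset nB sq≮ssnA (subst (suc q <_) (trans period≡ (+-suc (suc nA) nB)) p<L)
  ... | t , t<nB , sq≡ with suc t <? nB
  ...   | yes st<nB = in-B st<nB sq≡
  ...   | no st≮nB = contradiction (trans (cong walk ends-at-period) at-end) ≢x′
    where
    ends-at-period : suc (suc q) ≡ suc nA + suc nB
    ends-at-period = trans (cong suc sq≡) (trans (sym (+-suc (suc (suc nA)) t))
                       (trans (cong (suc (suc nA) +_) (≤-antisym t<nB (≮⇒≥ st≮nB))) (sym (+-suc (suc nA) nB))))

  old-covered-at : ∀ {p} → OldStep p → Covered (inj₁ (walk p) , inj₁ (walk (suc p)))
  old-covered-at (in-A {q} sq<nA refl) =
    covered-at q (<period′-A (<⇒≤ (<-trans (n<1+n q) sq<nA))) (edge-A sq<nA) (inj₁ (refl , refl))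
  old-covered-at (in-B {t} st<nB refl) =
    covered-at (nA + 5 + t) (<period′-B (<⇒≤ (<-trans (n<1+n t) st<nB))) (edge-B st<nB)
      (inj₁ (refl , cong (inj₁ ∘ walk) (sym (+-suc (suc (suc nA)) t))))

  old-covered : ∀ {u v} → u ≢ x → v ≢ x → adj H u v ≡ true → Covered (inj₁ u , inj₁ v)
  old-covered {u} {v} u≢x v≢x uv =
    let (p , p<L , same) = edge-surjective uv
        (r , r<L , same′) = old-covered-at (old-step p<L (first≢x same) (second≢x same))
    in r , r<L , SameEdge-trans (SameEdge-map inj₁ same) same′
    where
    first≢x : ∀ {p q} → SameEdge (u , v) (p , q) → p ≢ x
    first≢x (inj₁ (refl , _)) = u≢x
    first≢x (inj₂ (_ , refl)) = v≢x
    second≢x : ∀ {p q} → SameEdge (u , v) (p , q) → q ≢ x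
    second≢x (inj₁ (_ , refl)) = v≢x
    second≢x (inj₂ (refl , _)) = u≢x

  isNbr-neighbour : ∀ {v} → adj H x v ≡ true → isNbr v ≡ true
  isNbr-neighbour {v} xv =
    trans (cong (λ z → (v == a) ∨ ((v == b) ∨ ((v == c) ∨ z))) (sym (∨-identityʳ (v == d)))) (∈⇒∈ᵇ (neighbours xv))

  kept-edge-avoids-x : ∀ {u v} → adj H u v ≡ true → not (removed u v) ≡ true → u ≢ x × v ≢ x
  kept-edge-avoids-x {u} {v} uv kept = u≢x , v≢x
    where
    u≢x : u ≢ x
    u≢x refl rewrite ≡⇒== {u = x} refl | isNbr-neighbour uv = true≢false (sym kept)
    v≢x : v ≢ x
    v≢x refl rewrite ≡⇒== {u = x} refl | isNbr-neighbour (trans (adj-sym H x u) uv) | ∨-zeroʳ ((u == x) ∧ isNbr x) =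
      true≢false (sym kept)

  expanded-edge-surjective : ∀ {w w′} → adj⊎ w w′ ≡ true → Covered (w , w′)
  expanded-edge-surjective {inj₁ u} {inj₁ v} ww′ =
    let (u≢x , v≢x) = kept-edge-avoids-x (∧-l ww′) (∧-r ww′) in old-covered u≢x v≢x (∧-l ww′)
    where
    ∧-l : ∀ {p q} → (p ∧ q) ≡ true → p ≡ true
    ∧-l {true} _ = refl
    ∧-r : ∀ {p q} → (p ∧ q) ≡ true → q ≡ true
    ∧-r {true} q = q
  expanded-edge-surjective {inj₁ u} {inj₂ i} ww′ with u == x in u=x
  ... | true rewrite ==⇒≡ u=x = wheel-covered f0 (fs i) refl
  ... | false rewrite ==⇒≡ ww′ = link-covered i
  expanded-edge-surjective {inj₂ i} {inj₁ u} ww′ =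
    let (r , r<L , same) = expanded-edge-surjective {inj₁ u} {inj₂ i} ww′ in r , r<L , SameEdge-trans (inj₂ (refl , refl)) same
  expanded-edge-surjective {inj₂ i} {inj₂ j} ww′ = wheel-covered (fs i) (fs j) ww′

  private
    wheel-vertex≢old : ∀ g {u} → u ≢ x → wheel-vertex g ≢ inj₁ u
    wheel-vertex≢old g u≢x eq = u≢x (wheel-vertex-old eq)

    expanded-% : ∀ {r} → r < period′ → expanded (r % period′) ≡ expanded r
    expanded-% r<L = cong expanded (m<n⇒m%n≡m r<L)

  no-return-from-A : ∀ {q ℓ} → q < nA → 1 ≤ ℓ → ℓ ≤ 4 → expanded ((q + ℓ) % period′) ≢ expanded q
  no-return-from-A {q} {ℓ} q<nA 1≤ℓ ℓ≤4 with q + ℓ <? nA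
  ... | yes q+ℓ<nA = λ eq → no-short-return (suc q) ℓ 1≤ℓ ℓ≤4 (inj₁-injective (begin
          inj₁ (walk (suc q + ℓ))       ≡⟨ expanded-A q+ℓ<nA ⟨
          expanded (q + ℓ)              ≡⟨ expanded-% (<period′-A (<⇒≤ q+ℓ<nA)) ⟨
          expanded ((q + ℓ) % period′)  ≡⟨ eq ⟩
          expanded q                    ≡⟨ expanded-A q<nA ⟩
          inj₁ (walk (suc q))           ∎))
  ... | no q+ℓ≮nA with offset 5 q+ℓ≮nA (<-≤-trans (+-mono-<-≤ q<nA ℓ≤4) (+-monoʳ-≤ nA (n≤1+n 4)))
  ...   | o , o<5 , q+ℓ≡ = λ eq → wheel-vertex≢old (crossing true o) (avoids-A q<nA) (begin
          wheel-vertex (crossing true o)  ≡⟨ expanded-first o<5 ⟨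
          expanded (nA + o)               ≡⟨ cong expanded q+ℓ≡ ⟨
          expanded (q + ℓ)                ≡⟨ expanded-% (subst (_< period′) (sym q+ℓ≡) (<period′-first (<⇒≤ o<5))) ⟨
          expanded ((q + ℓ) % period′)    ≡⟨ eq ⟩
          expanded q                      ≡⟨ expanded-A q<nA ⟩
          inj₁ (walk (suc q))             ∎)

  no-return-from-first : ∀ {o ℓ} → o < 5 → 1 ≤ ℓ → ℓ ≤ 4 → expanded ((nA + o + ℓ) % period′) ≢ expanded (nA + o)
  no-return-from-first {o} {ℓ} o<5 1≤ℓ ℓ≤4 with o + ℓ <? 5
  ... | yes o+ℓ<5 = λ eq → <⇒≢ (m<m+n o 1≤ℓ) (sym (tour-injective in₁ out₁ in₁≢out₁ o+ℓ<5 o<5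
          (wheel-vertex-injective (begin
            wheel-vertex (crossing true (o + ℓ))   ≡⟨ expanded-first o+ℓ<5 ⟨
            expanded (nA + (o + ℓ))                ≡⟨ cong expanded (+-assoc nA o ℓ) ⟨
            expanded (nA + o + ℓ)                  ≡⟨ expanded-% (subst (_< period′) (sym (+-assoc nA o ℓ)) (<period′-first (<⇒≤ o+ℓ<5))) ⟨
            expanded ((nA + o + ℓ) % period′)      ≡⟨ eq ⟩
            expanded (nA + o)                      ≡⟨ expanded-first o<5 ⟩
            wheel-vertex (crossing true o)         ∎))))
  ... | no o+ℓ≮5 with offset 4 o+ℓ≮5 (+-mono-<-≤ o<5 ℓ≤4)
  ...   | t , t<4 , o+ℓ≡ = λ eq → wheel-vertex≢old (crossing true o) (avoids-B t<nB) (sym (begin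
          inj₁ (walk (suc (suc nA) + t))      ≡⟨ expanded-B t<nB ⟨
          expanded (nA + 5 + t)               ≡⟨ cong expanded position≡ ⟨
          expanded (nA + o + ℓ)               ≡⟨ expanded-% (subst (_< period′) (sym position≡) (<period′-B (<⇒≤ t<nB))) ⟨
          expanded ((nA + o + ℓ) % period′)   ≡⟨ eq ⟩
          expanded (nA + o)                   ≡⟨ expanded-first o<5 ⟩
          wheel-vertex (crossing true o)      ∎))
    where
    t<nB : t < nB
    t<nB = <-≤-trans t<4 4≤nB
    position≡ : nA + o + ℓ ≡ nA + 5 + t
    position≡ = trans (+-assoc nA o ℓ) (trans (cong (nA +_) o+ℓ≡) (sym (+-assoc nA 5 t)))

  no-return-from-B : ∀ {q ℓ} → q < nB → 1 ≤ ℓ → ℓ ≤ 4 → expanded ((nA + 5 + q + ℓ) % period′) ≢ expanded (nA + 5 + q)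
  no-return-from-B {q} {ℓ} q<nB 1≤ℓ ℓ≤4 with q + ℓ <? nB
  ... | yes q+ℓ<nB = λ eq → no-short-return (suc (suc nA) + q) ℓ 1≤ℓ ℓ≤4 (inj₁-injective (begin
          inj₁ (walk (suc (suc nA) + q + ℓ))   ≡⟨ cong (inj₁ ∘ walk) (+-assoc (suc (suc nA)) q ℓ) ⟩
          inj₁ (walk (suc (suc nA) + (q + ℓ))) ≡⟨ expanded-B q+ℓ<nB ⟨
          expanded (nA + 5 + (q + ℓ))         ≡⟨ cong expanded (+-assoc (nA + 5) q ℓ) ⟨
          expanded (nA + 5 + q + ℓ)           ≡⟨ expanded-% (subst (_< period′) (sym (+-assoc (nA + 5) q ℓ)) (<period′-B (<⇒≤ q+ℓ<nB))) ⟨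
          expanded ((nA + 5 + q + ℓ) % period′) ≡⟨ eq ⟩
          expanded (nA + 5 + q)               ≡⟨ expanded-B q<nB ⟩
          inj₁ (walk (suc (suc nA) + q))      ∎))
  ... | no q+ℓ≮nB with offset 5 q+ℓ≮nB (+-mono-<-≤ q<nB (≤-trans ℓ≤4 (n≤1+n 4)))
  ...   | o , o<5 , q+ℓ≡ = λ eq → wheel-vertex≢old (crossing false o) (avoids-B q<nB) (begin
          wheel-vertex (crossing false o)       ≡⟨ expanded-second o<5 ⟨
          expanded (nA + 5 + nB + o)            ≡⟨ cong expanded position≡ ⟨
          expanded (nA + 5 + q + ℓ)             ≡⟨ expanded-% (subst (_< period′) (sym position≡) (<period′-second (≤-pred o<5))) ⟨
          expanded ((nA + 5 + q + ℓ) % period′) ≡⟨ eq ⟩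
          expanded (nA + 5 + q)                 ≡⟨ expanded-B q<nB ⟩
          inj₁ (walk (suc (suc nA) + q))        ∎)
    where
    position≡ : nA + 5 + q + ℓ ≡ nA + 5 + nB + o
    position≡ = trans (+-assoc (nA + 5) q ℓ) (trans (cong (nA + 5 +_) q+ℓ≡) (sym (+-assoc (nA + 5) nB o)))

  no-return-from-second : ∀ {o ℓ} → o < 5 → 1 ≤ ℓ → ℓ ≤ 4 →
                          expanded ((nA + 5 + nB + o + ℓ) % period′) ≢ expanded (nA + 5 + nB + o)
  no-return-from-second {o} {ℓ} o<5 1≤ℓ ℓ≤4 with o + ℓ <? 5
  ... | yes o+ℓ<5 = λ eq → <⇒≢ (m<m+n o 1≤ℓ) (sym (tour-injective in₂ out₂ in₂≢out₂ o+ℓ<5 o<5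
          (wheel-vertex-injective (begin
            wheel-vertex (crossing false (o + ℓ))       ≡⟨ expanded-second o+ℓ<5 ⟨
            expanded (nA + 5 + nB + (o + ℓ))            ≡⟨ cong expanded (+-assoc (nA + 5 + nB) o ℓ) ⟨
            expanded (nA + 5 + nB + o + ℓ)              ≡⟨ expanded-% (subst (_< period′) (sym (+-assoc (nA + 5 + nB) o ℓ)) (<period′-second (≤-pred o+ℓ<5))) ⟨
            expanded ((nA + 5 + nB + o + ℓ) % period′)  ≡⟨ eq ⟩
            expanded (nA + 5 + nB + o)                  ≡⟨ expanded-second o<5 ⟩
            wheel-vertex (crossing false o)             ∎))))
  ... | no o+ℓ≮5 with offset 4 o+ℓ≮5 (+-mono-<-≤ o<5 ℓ≤4)
  ...   | t , t<4 , o+ℓ≡ = λ eq → wheel-vertex≢old (crossing false o) (avoids-A t<nA) (sym (begin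
          inj₁ (walk (suc t))                         ≡⟨ expanded-A t<nA ⟨
          expanded t                                  ≡⟨ expanded-% (<period′-A (<⇒≤ t<nA)) ⟨
          expanded (t % period′)                      ≡⟨ cong expanded ([m+n]%n≡m%n t period′) ⟨
          expanded ((t + period′) % period′)          ≡⟨ cong (λ z → expanded (z % period′)) position≡ ⟨
          expanded ((nA + 5 + nB + o + ℓ) % period′)  ≡⟨ eq ⟩
          expanded (nA + 5 + nB + o)                  ≡⟨ expanded-second o<5 ⟩
          wheel-vertex (crossing false o)             ∎))
    where
    t<nA : t < nA
    t<nA = <-≤-trans t<4 4≤nA
    position≡ : nA + 5 + nB + o + ℓ ≡ t + period′
    position≡ = trans (+-assoc (nA + 5 + nB) o ℓ) (trans (cong (nA + 5 + nB +_) o+ℓ≡) (identity (nA + 5 + nB) t))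
      where
      identity : ∀ m t → m + (5 + t) ≡ t + suc (m + 4)
      identity = solve-∀

  expanded-no-short-return : ∀ {r} ℓ → r < period′ → 1 ≤ ℓ → ℓ ≤ 4 → expanded ((r + ℓ) % period′) ≢ expanded r
  expanded-no-short-return ℓ r<L with segment r<L
  ... | on-A      q<nA refl = no-return-from-A q<nA
  ... | on-first  o<5  refl = no-return-from-first o<5
  ... | on-B      q<nB refl = no-return-from-B q<nB
  ... | on-second o<5  refl = no-return-from-second o<5

  expanded-tour : EulerTour adj⊎
  expanded-tour = cyclic-tour last′ expanded expanded-adjacent expanded-edge-injective
                              expanded-edge-surjective expanded-no-short-return

endpoint-visited : ∀ {V} {E : V → V → Bool} (T : EulerTour E) {x a} → E x a ≡ true →
                   ∃[ s ] EulerTour.walk T s ≡ x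
endpoint-visited T xa with EulerTour.edge-surjective T xa
... | p , _ , inj₁ (x≡ , _) = p , sym x≡
... | p , _ , inj₂ (x≡ , _) = suc p , sym x≡

rotate-to : ∀ {V} {E : V → V → Bool} (T : EulerTour E) {x a} → E x a ≡ true →
            Σ (EulerTour E) λ T′ → EulerTour.walk T′ 0 ≡ x
rotate-to T xa =
  let (s , at-s) = endpoint-visited T xa in shift T s , trans (cong (EulerTour.walk T) (+-identityʳ s)) at-s

lemma1 : (G H : Graph)
    → ThreeConnected G → ThreeConnected H
    → Quartic G → Quartic H
    → Planar G → Planar H
    → FourCycleAddition H G
    → Has4LSAEulerianCircuit H
    → Has4LSAEulerianCircuit G
lemma1 G H _ _ _ quartic-H _ _ (rot , (isRot , _) , x , a , x∼a , π , iso) (C , eulerian , avoiding) =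
  circuit-of-tour (transport (↔-trans π +↔⊎) iso (Expansion.expanded-tour H ends-adjacent neighbours twice))
  where
  open RotationAt H isRot (quartic-H x) x∼a
  from-x : Σ (EulerTour (adj H)) λ T → EulerTour.walk T 0 ≡ x
  from-x = rotate-to (tour-of-circuit C eulerian avoiding) x∼a
  twice : TwoVisits (proj₁ from-x) x
  twice = two-visits H (quartic-H x) (proj₁ from-x) (proj₂ from-x)
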